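{- Let $n\ge2$, let $\pi\in\mathfrak{S}_n$ be a separable permutation, and let $T$ be a separating tree of $\pi$ with root $V_0$. Let $S^{ - }(\pi)$ be the set of all negative internal nodes of $T$, other than $V_0$, whose parents are not negative, and $S^{+}(\pi)$ the set of all positive internal nodes of $T$, other than $V_0$, whose parents are not positive. For an internal node $V$ let $N(V)$ be the number of leaves of the subtree rooted at $V$, and set empty products equal to $1$. Then $$F(\Lambda_\pi,q)=\begin{cases}\dfrac{\prod_{V_i\in S^{ - }(\pi)}[N(V_i)]!}{\prod_{V_j\in S^{+}(\pi)}[N(V_j)]!}, & V_0 \text{ positive},\\[2ex] \dfrac{\prod_{V_i\in S^{ - }(\pi)}[N(V_i)]!}{\prod_{V_j\in S^{+}(\pi)}[N(V_j)]!}\,[N(V_0)]!, & V_0\text{ negative},\end{cases}$$ $$F(V_\pi,q)=\begin{cases}\dfrac{\prod_{V_i\in S^{+}(\pi)}[N(V_i)]!}{\prod_{V_j\in S^{ - }(\pi)}[N(V_j)]!}\,[N(V_0)]!, & V_0 \text{ positive},\\[2ex] \dfrac{\prod_{V_i\in S^{+}(\pi)}[N(V_i)]!}{\prod_{V_j\in S^{ - }(\pi)}[N(V_j)]!}, & V_0\text{ negative}.\end{cases}$$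
   Context: $\mathfrak{S}_n$ is the symmetric group on $\{1,\dots,n\}$, permutations in one-line notation, products composed right-to-left. Length $\ell(\pi)=\#\{i<j:a_i>a_j\}$. With $s_i=(i,i+1)$, the weak order is generated by covers $\pi\lessdot\sigma$ when $\sigma=\pi s_i$ and $\ell(\sigma)>\ell(\pi)$; $w_0=n(n-1)\cdots1$. $F(\Lambda_\pi,q)=\sum_{u\in[\mathrm{id},\pi]}q^{\ell(u)}$ and $F(V_\pi,q)=\sum_{v\in[\pi,w_0]}q^{\ell(v)-\ell(\pi)}$. $[i]=1+q+\cdots+q^{i-1}$, $[k]!=[1][2]\cdots[k]$. A permutation (or word of distinct integers) is separable if it has no $i<j<k<h$ with $a_j<a_h<a_i<a_k$ or $a_k<a_i<a_h<a_j$. Every separable word of length $k\ge2$ whose letters form a set of consecutive integers can be written as a concatenation $\pi_A\pi_B$ of two nonempty separable words such that either all letters of $\pi_A$ are smaller than all letters of $\pi_B$, or all letters of $\pi_A$ are larger than all letters of $\pi_B$. A separating tree of such a word is defined recursively: a word of length $1$ has as tree a single leaf labeled by its letter; for length $\ge2$, choose such a decomposition $\pi=\pi_A\pi_B$, and the separating tree is an ordered binary tree whose root has left subtree a separating tree of $\pi_A$ and right subtree a separating tree of $\pi_B$ (separating trees need not be unique). The leaves below each internal node form a set of consecutive integers. An internal node is negative if the leaf labels below its left child are greater than those below its right child, and positive if they are smaller. -}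

module Defs where

open import Data.Nat using (ℕ; zero; suc; _+_; _*_; _∸_; _^_; _≤_; _<_; _<ᵇ_)
open import Data.Bool using (Bool; true; false; not; _∧_; if_then_else_)
open import Data.List using (List; []; _∷_; _++_; map; length; upTo; reverse; filter)
open import Data.Nat.ListAction using (sum; product)
open import Data.List.Relation.Binary.Sublist.Propositional using (_⊆_)
open import Data.List.Relation.Unary.All using (All)
open import Data.Product using (Σ; _×_; _,_; proj₁; proj₂)
open import Data.Sum using (_⊎_)
open import Data.Unit using (⊤)
open import Relation.Nullary using (¬_)
open import Relation.Binary.PropositionalEquality using (_≡_)
open import Relation.Binary.Construct.Closure.ReflexiveTransitive using (Star)

-- Permutations in one-line notation are lists of naturals.

range : ℕ → List ℕ
range n = map suc (upTo n)

w₀ : ℕ → List ℕ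
w₀ n = reverse (range n)

countSmaller : ℕ → List ℕ → ℕ
countSmaller a []      = 0
countSmaller a (b ∷ w) = (if b <ᵇ a then 1 else 0) + countSmaller a w

inv : List ℕ → ℕ
inv []      = 0
inv (a ∷ w) = countSmaller a w + inv w

-- right multiplication by s_{i+1}: swap the letters in positions i+1, i+2
-- (0-based positions i, i+1); identity if out of range.
swapAt : ℕ → List ℕ → List ℕ
swapAt zero    (a ∷ b ∷ w) = b ∷ a ∷ w
swapAt zero    w           = w
swapAt (suc i) []          = []
swapAt (suc i) (a ∷ w)     = a ∷ swapAt i w

Cover : List ℕ → List ℕ → Set
Cover π σ = Σ ℕ (λ i → (σ ≡ swapAt i π) × (inv π < inv σ))

_≤w_ : List ℕ → List ℕ → Set
_≤w_ = Star Cover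

-- Separable permutations (avoiding 3142 and 2413)

Separable : List ℕ → Set
Separable w = ∀ a b c d → (a ∷ b ∷ c ∷ d ∷ []) ⊆ w →
  ¬ (b < d × d < a × a < c) × ¬ (c < a × a < d × d < b)

data Tree : Set where
  leaf : ℕ → Tree
  node : Tree → Tree → Tree

leaves : Tree → List ℕ
leaves (leaf a)   = a ∷ []
leaves (node l r) = leaves l ++ leaves r

AllLess : List ℕ → List ℕ → Set
AllLess xs ys = All (λ x → All (λ y → x < y) ys) xs

IsSepTree : Tree → Set
IsSepTree (leaf a)   = ⊤
IsSepTree (node l r) = IsSepTree l × IsSepTree r ×
  (AllLess (leaves l) (leaves r) ⊎ AllLess (leaves r) (leaves l))

SeparatingTree : Tree → List ℕ → Set
SeparatingTree T π = IsSepTree T × (leaves T ≡ π)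

firstLeaf : Tree → ℕ
firstLeaf (leaf a)   = a
firstLeaf (node l _) = firstLeaf l

-- Sign of an internal node (leaves are neither).  In a separating tree all
-- left labels are on one side of all right labels, so comparing the first
-- leaf label of each side decides the sign.
isPos : Tree → Bool
isPos (leaf _)   = false
isPos (node l r) = firstLeaf l <ᵇ firstLeaf r

isNeg : Tree → Bool
isNeg (leaf _)   = false
isNeg (node l r) = firstLeaf r <ᵇ firstLeaf l

N : Tree → ℕ
N t = length (leaves t)

-- all (parent , child) pairs; the children are exactly the non-root nodes
edges : Tree → List (Tree × Tree)
edges (leaf _)   = []
edges (node l r) = (node l r , l) ∷ (node l r , r) ∷ (edges l ++ edges r)

Sminus : Tree → List Tree
Sminus t = map proj₂ (filter (λ e → Data.Bool.T? (isNeg (proj₂ e) ∧ not (isNeg (proj₁ e)))) (edges t))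

Splus : Tree → List Tree
Splus t = map proj₂ (filter (λ e → Data.Bool.T? (isPos (proj₂ e) ∧ not (isPos (proj₁ e)))) (edges t))

-- q-integers and q-factorials, evaluated at q

qint : ℕ → ℕ → ℕ
qint q i = sum (map (λ j → q ^ j) (upTo i))

qfact : ℕ → ℕ → ℕ
qfact q k = product (map (λ i → qint q (suc i)) (upTo k))

prodFact : ℕ → List Tree → ℕ
prodFact q S = product (map (λ V → qfact q (N V)) S)

-- F(Λ_π,q) given a duplicate-free enumeration L of [id, π]
FΛ : ℕ → List (List ℕ) → ℕ
FΛ q L = sum (map (λ u → q ^ inv u) L)

-- F(V_π,q) given a duplicate-free enumeration M of [π, w₀]
FV : ℕ → List ℕ → List (List ℕ) → ℕ
FV q π M = sum (map (λ v → q ^ (inv v ∸ inv π)) M)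

module Submission where

-- The weak order is the closure of exchanging adjacent ascents.  If every letter of x
-- is below every letter of y (a positive node), the words below x ++ y are the u ++ v
-- with u below x and v below y; if every letter of y is below every letter of x (a
-- negative node), they are the interleavings of such u and v; dually above x ++ y.
-- Following a separating tree this yields repetition-free enumerations of both
-- intervals, over which q^ℓ sums to a product of Gaussian binomials, one per negative
-- (resp. positive) node.  Since [m+k choose m] [m]! [k]! = [m+k]!, these products
-- telescope along runs of equally signed nodes into the factorials over S⁻ and S⁺.

open import Defs
open import Data.Nat
open import Data.Nat.Properties
open import Data.Nat.ListAction using (sum; product)
open import Data.Nat.ListAction.Properties using (sum-++; product-++; sum-↭)
open import Data.Nat.Tactic.RingSolver using (solve-∀)
open import Data.Bool using (Bool; true; false; T; T?; not; _∧_; if_then_else_)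
open import Data.Bool.Properties using (∧-zeroʳ; ∧-identityʳ)
open import Data.Unit using (tt)
open import Data.Empty using (⊥; ⊥-elim)
open import Data.Product using (Σ; _×_; _,_; proj₁; proj₂)
open import Data.Sum using (_⊎_; inj₁; inj₂)
open import Data.List using (List; []; _∷_; _++_; map; length; filter; concatMap; upTo; downFrom)
open import Data.List.Properties
  using (++-assoc; length-++; map-++; filter-++; filter-accept; filter-reject; filter-all; filter-none;
         ∷-injectiveˡ; ∷-injectiveʳ; reverse-map; reverse-upTo; upTo-∷ʳ)
open import Data.List.Relation.Unary.All as All using (All; []; _∷_)
open import Data.List.Relation.Unary.AllPairs using (AllPairs; []; _∷_)
import Data.List.Relation.Unary.AllPairs.Properties as AllPairs
open import Data.List.Relation.Unary.Any using (here; there)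
open import Data.List.Membership.Propositional using (_∈_; find; lose)
open import Data.List.Membership.Propositional.Properties
  using (∈-∃++; ∈-++⁺ˡ; ∈-++⁺ʳ; ∈-++⁻; ∈-map⁺; ∈-map⁻; ∈-concatMap⁺; ∈-concatMap⁻)
open import Data.List.Membership.Propositional.Properties.WithK using (unique∧set⇒bag)
open import Data.List.Membership.DecPropositional _≟_ using (_∈?_)
open import Data.List.Relation.Binary.BagAndSetEquality using (∼bag⇒↭)
open import Data.List.Relation.Binary.Disjoint.Propositional using (Disjoint)
open import Data.List.Relation.Unary.Unique.Propositional using (Unique)
import Data.List.Relation.Unary.Unique.Propositional.Properties as Unique
open import Data.List.Relation.Ternary.Interleaving.Propositional {A = ℕ}
  using (Interleaving; []; consˡ; consʳ; toPermutation; swap)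
open import Data.List.Relation.Binary.Permutation.Propositional using (_↭_; ↭-refl; ↭-sym; ↭-trans)
import Data.List.Relation.Binary.Permutation.Propositional as Perm
open import Data.List.Relation.Binary.Permutation.Propositional.Properties
  using (++⁺ˡ; ∈-resp-↭; drop-mid; ↭-empty-inv; ↭-length; ↭-reverse)
  renaming (map⁺ to ↭-map⁺)
open import Function.Base using (id; _∘_)
open import Function.Bundles using (_⇔_; mk⇔; Equivalence)
import Function.Properties.Equivalence as ⇔
open import Relation.Nullary using (¬_; yes; no)
open import Relation.Unary using (Decidable)
open import Relation.Binary.PropositionalEquality
open import Relation.Binary.Construct.Closure.ReflexiveTransitive using (Star; ε; _◅_; _◅◅_; gmap)

<ᵇ-true : ∀ {m n} → m < n → (m <ᵇ n) ≡ true
<ᵇ-true {m} {n} m<n with m <ᵇ n | <⇒<ᵇ m<n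
... | true | _ = refl

<ᵇ-false : ∀ {m n} → ¬ m < n → (m <ᵇ n) ≡ false
<ᵇ-false {m} {n} m≮n with m <ᵇ n in eq
... | false = refl
... | true  = ⊥-elim (m≮n (<ᵇ⇒< m n (subst T (sym eq) tt)))

smaller : ℕ → ℕ → ℕ
smaller b a = if b <ᵇ a then 1 else 0

smaller-true : ∀ {b a} → b < a → smaller b a ≡ 1
smaller-true b<a rewrite <ᵇ-true b<a = refl

smaller-false : ∀ {b a} → ¬ b < a → smaller b a ≡ 0
smaller-false b≮a rewrite <ᵇ-false b≮a = refl

countSmaller-++ : ∀ a u v → countSmaller a (u ++ v) ≡ countSmaller a u + countSmaller a v
countSmaller-++ a []      v = refl
countSmaller-++ a (b ∷ u) v =
  trans (cong (smaller b a +_) (countSmaller-++ a u v)) (sym (+-assoc (smaller b a) _ _))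

countSmaller-↭ : ∀ a {u v} → u ↭ v → countSmaller a u ≡ countSmaller a v
countSmaller-↭ a Perm.refl          = refl
countSmaller-↭ a (Perm.prep b p)    = cong (_ +_) (countSmaller-↭ a p)
countSmaller-↭ a (Perm.swap b c p)  =
  trans (cong (λ k → smaller b a + (smaller c a + k)) (countSmaller-↭ a p)) (exchange (smaller b a) (smaller c a) _)
  where
  exchange : ∀ i j k → i + (j + k) ≡ j + (i + k)
  exchange = solve-∀
countSmaller-↭ a (Perm.trans p p′) = trans (countSmaller-↭ a p) (countSmaller-↭ a p′)

countSmaller-above : ∀ a w → All (a <_) w → countSmaller a w ≡ 0
countSmaller-above a []      []           = refl
countSmaller-above a (b ∷ w) (a<b ∷ a<w) rewrite smaller-false (<⇒≯ a<b) = countSmaller-above a w a<w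

countSmaller-below : ∀ a w → All (_< a) w → countSmaller a w ≡ length w
countSmaller-below a []      []           = refl
countSmaller-below a (b ∷ w) (b<a ∷ w<a) rewrite smaller-true b<a = cong suc (countSmaller-below a w w<a)

cross : List ℕ → List ℕ → ℕ
cross []      v = 0
cross (a ∷ u) v = countSmaller a v + cross u v

inv-++ : ∀ u v → inv (u ++ v) ≡ inv u + inv v + cross u v
inv-++ []      v = sym (+-identityʳ (inv v))
inv-++ (a ∷ u) v rewrite countSmaller-++ a u v | inv-++ u v =
  regroup (countSmaller a u) (countSmaller a v) (inv u) (inv v) (cross u v)
  where
  regroup : ∀ i j k l m → i + j + (k + l + m) ≡ i + k + l + (j + m)
  regroup = solve-∀

cross-↭ʳ : ∀ u {v v′} → v ↭ v′ → cross u v ≡ cross u v′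
cross-↭ʳ []      p = refl
cross-↭ʳ (a ∷ u) p = cong₂ _+_ (countSmaller-↭ a p) (cross-↭ʳ u p)

infix 4 _≪_
_≪_ : List ℕ → List ℕ → Set
u ≪ v = ∀ {a b} → a ∈ u → b ∈ v → a < b

cross-≪ : ∀ u v → u ≪ v → cross u v ≡ 0
cross-≪ []      v u≪v = refl
cross-≪ (a ∷ u) v u≪v
  rewrite countSmaller-above a v (All.tabulate (u≪v (here refl))) = cross-≪ u v (λ a∈ → u≪v (there a∈))

cross-≫ : ∀ u v → v ≪ u → cross u v ≡ length u * length v
cross-≫ []      v v≪u = refl
cross-≫ (a ∷ u) v v≪u
  rewrite countSmaller-below a v (All.tabulate (λ b∈ → v≪u b∈ (here refl))) =
  cong (length v +_) (cross-≫ u v (λ b∈ a∈ → v≪u b∈ (there a∈)))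

inv-++-≪ : ∀ u v → u ≪ v → inv (u ++ v) ≡ inv u + inv v
inv-++-≪ u v u≪v rewrite inv-++ u v | cross-≪ u v u≪v = +-identityʳ _

inv-++-≫ : ∀ u v → v ≪ u → inv (u ++ v) ≡ inv u + inv v + length u * length v
inv-++-≫ u v v≪u rewrite inv-++ u v | cross-≫ u v v≪u = refl

inv-suffix-↭ : ∀ p {w w′} → w ↭ w′ → inv (p ++ w) + inv w′ ≡ inv (p ++ w′) + inv w
inv-suffix-↭ p {w} {w′} w↭w′ rewrite inv-++ p w | inv-++ p w′ | cross-↭ʳ p w↭w′ =
  exchange (inv p) (inv w) (inv w′) (cross p w′)
  where
  exchange : ∀ i j k l → i + j + l + k ≡ i + k + l + j
  exchange = solve-∀

inv-head-swap : ∀ x y s → inv (y ∷ x ∷ s) + smaller y x ≡ inv (x ∷ y ∷ s) + smaller x y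
inv-head-swap x y s = exchange (smaller x y) (smaller y x) (countSmaller y s) (countSmaller x s) (inv s)
  where
  exchange : ∀ i j k l m → i + k + (l + m) + j ≡ j + l + (k + m) + i
  exchange = solve-∀

inv-ascent : ∀ p {x y} s → x < y → inv (p ++ y ∷ x ∷ s) ≡ suc (inv (p ++ x ∷ y ∷ s))
inv-ascent p {x} {y} s x<y = sym (+-cancelʳ-≡ (inv (x ∷ y ∷ s)) _ _ (begin
    suc (inv (p ++ x ∷ y ∷ s)) + inv (x ∷ y ∷ s) ≡⟨ sym (+-suc _ _) ⟩
    inv (p ++ x ∷ y ∷ s) + suc (inv (x ∷ y ∷ s)) ≡⟨ cong (inv (p ++ x ∷ y ∷ s) +_) head ⟩
    inv (p ++ x ∷ y ∷ s) + inv (y ∷ x ∷ s)       ≡⟨ inv-suffix-↭ p (Perm.swap x y ↭-refl) ⟩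
    inv (p ++ y ∷ x ∷ s) + inv (x ∷ y ∷ s)       ∎))
  where
  open ≡-Reasoning
  head : suc (inv (x ∷ y ∷ s)) ≡ inv (y ∷ x ∷ s)
  head = begin
    suc (inv (x ∷ y ∷ s))             ≡⟨ +-comm 1 _ ⟩
    inv (x ∷ y ∷ s) + 1               ≡⟨ cong (inv (x ∷ y ∷ s) +_) (sym (smaller-true x<y)) ⟩
    inv (x ∷ y ∷ s) + smaller x y     ≡⟨ sym (inv-head-swap x y s) ⟩
    inv (y ∷ x ∷ s) + smaller y x     ≡⟨ cong (inv (y ∷ x ∷ s) +_) (smaller-false (<⇒≯ x<y)) ⟩
    inv (y ∷ x ∷ s) + 0               ≡⟨ +-identityʳ _ ⟩
    inv (y ∷ x ∷ s)                   ∎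

inv-nonascent : ∀ p {x y} s → ¬ x < y → inv (p ++ y ∷ x ∷ s) ≤ inv (p ++ x ∷ y ∷ s)
inv-nonascent p {x} {y} s x≮y = +-cancelʳ-≤ (inv (x ∷ y ∷ s)) _ _ (begin
    inv (p ++ y ∷ x ∷ s) + inv (x ∷ y ∷ s) ≡⟨ sym (inv-suffix-↭ p (Perm.swap x y ↭-refl)) ⟩
    inv (p ++ x ∷ y ∷ s) + inv (y ∷ x ∷ s) ≤⟨ +-monoʳ-≤ (inv (p ++ x ∷ y ∷ s)) head ⟩
    inv (p ++ x ∷ y ∷ s) + inv (x ∷ y ∷ s) ∎)
  where
  open ≤-Reasoning
  head : inv (y ∷ x ∷ s) ≤ inv (x ∷ y ∷ s)
  head = begin
    inv (y ∷ x ∷ s)                   ≤⟨ m≤m+n _ _ ⟩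
    inv (y ∷ x ∷ s) + smaller y x     ≡⟨ inv-head-swap x y s ⟩
    inv (x ∷ y ∷ s) + smaller x y     ≡⟨ cong (inv (x ∷ y ∷ s) +_) (smaller-false x≮y) ⟩
    inv (x ∷ y ∷ s) + 0               ≡⟨ +-identityʳ _ ⟩
    inv (x ∷ y ∷ s)                   ∎

infix 4 _⋖_ _≼_
data _⋖_ : List ℕ → List ℕ → Set where
  ascent : ∀ p {x y} s → x < y → p ++ x ∷ y ∷ s ⋖ p ++ y ∷ x ∷ s

_≼_ : List ℕ → List ℕ → Set
_≼_ = Star _⋖_

data SwapAt (i : ℕ) (w : List ℕ) : Set where
  outside : swapAt i w ≡ w → SwapAt i w
  inside  : ∀ p x y s → w ≡ p ++ x ∷ y ∷ s → swapAt i w ≡ p ++ y ∷ x ∷ s → SwapAt i w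

swapAt-view : ∀ i w → SwapAt i w
swapAt-view zero    []          = outside refl
swapAt-view zero    (a ∷ [])    = outside refl
swapAt-view zero    (a ∷ b ∷ w) = inside [] a b w refl refl
swapAt-view (suc i) []          = outside refl
swapAt-view (suc i) (a ∷ w) with swapAt-view i w
... | outside e            = outside (cong (a ∷_) e)
... | inside p x y s e₁ e₂ = inside (a ∷ p) x y s (cong (a ∷_) e₁) (cong (a ∷_) e₂)

swapAt-length : ∀ p x y s → swapAt (length p) (p ++ x ∷ y ∷ s) ≡ p ++ y ∷ x ∷ s
swapAt-length []      x y s = refl
swapAt-length (a ∷ p) x y s = cong (a ∷_) (swapAt-length p x y s)

cover⇒⋖ : ∀ {u v} → Cover u v → u ⋖ v
cover⇒⋖ {u} {v} (i , v≡ , u<v) with swapAt-view i u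
... | outside e = ⊥-elim (<-irrefl refl (subst (λ w → inv u < inv w) (trans v≡ e) u<v))
... | inside p x y s refl e with x <? y
...   | yes x<y = subst (u ⋖_) (sym (trans v≡ e)) (ascent p s x<y)
...   | no  x≮y = ⊥-elim (<⇒≱ (subst (λ w → inv u < inv w) (trans v≡ e) u<v) (inv-nonascent p s x≮y))

⋖⇒cover : ∀ {u v} → u ⋖ v → Cover u v
⋖⇒cover (ascent p {x} {y} s x<y) =
  length p , sym (swapAt-length p x y s) , subst (inv (p ++ x ∷ y ∷ s) <_) (sym (inv-ascent p s x<y)) ≤-refl

≤w⇒≼ : ∀ {u v} → u ≤w v → u ≼ v
≤w⇒≼ = gmap id cover⇒⋖

≼⇒≤w : ∀ {u v} → u ≼ v → u ≤w v
≼⇒≤w = gmap id ⋖⇒cover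

≼-prefix : ∀ p {u v} → u ≼ v → p ++ u ≼ p ++ v
≼-prefix p = gmap (p ++_) λ { (ascent q {x} {y} s x<y) →
  subst₂ _⋖_ (++-assoc p q (x ∷ y ∷ s)) (++-assoc p q (y ∷ x ∷ s)) (ascent (p ++ q) s x<y) }

≼-suffix : ∀ t {u v} → u ≼ v → u ++ t ≼ v ++ t
≼-suffix t = gmap (_++ t) λ { (ascent q {x} {y} s x<y) →
  subst₂ _⋖_ (sym (++-assoc q (x ∷ y ∷ s) t)) (sym (++-assoc q (y ∷ x ∷ s) t)) (ascent q (s ++ t) x<y) }

≼-++ : ∀ {a b c d} → a ≼ b → c ≼ d → a ++ c ≼ b ++ d
≼-++ {b = b} {c = c} a≼b c≼d = ≼-suffix c a≼b ◅◅ ≼-prefix b c≼d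

≼-↭ : ∀ {u v} → u ≼ v → u ↭ v
≼-↭ ε                          = ↭-refl
≼-↭ (ascent p {x} {y} s _ ◅ r) = ↭-trans (++⁺ˡ p (Perm.swap x y ↭-refl)) (≼-↭ r)

≼-inv : ∀ {u v} → u ≼ v → inv u ≤ inv v
≼-inv ε                        = ≤-refl
≼-inv (ascent p s x<y ◅ r) = ≤-trans (n≤1+n _) (subst (_≤ _) (inv-ascent p s x<y) (≼-inv r))

≼-length : ∀ {u v} → u ≼ v → length u ≡ length v
≼-length u≼v = ↭-length (≼-↭ u≼v)

⋖-long : ∀ {u v} → u ⋖ v → 2 ≤ length u
⋖-long (ascent []      s _) = s≤s (s≤s z≤n)
⋖-long (ascent (c ∷ p) s x<y) = m≤n⇒m≤1+n (⋖-long (ascent p s x<y))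

singleton-below : ∀ {u a} → u ≼ a ∷ [] → u ≡ a ∷ []
singleton-below ε               = refl
singleton-below (step ◅ steps) with ≤-trans (⋖-long step) (≤-reflexive (≼-length (step ◅ steps)))
... | s≤s ()

singleton-above : ∀ {v a} → a ∷ [] ≼ v → v ≡ a ∷ []
singleton-above ε              = refl
singleton-above (step ◅ steps) with ⋖-long step
... | s≤s ()

sink : ∀ a z s → All (a <_) z → a ∷ z ++ s ≼ z ++ a ∷ s
sink a []      s []            = ε
sink a (c ∷ z) s (a<c ∷ a<z) = ascent [] (z ++ s) a<c ◅ ≼-prefix (c ∷ []) (sink a z s a<z)

rise : ∀ a z s → All (_< a) z → z ++ a ∷ s ≼ a ∷ z ++ s
rise a []      s []            = ε
rise a (c ∷ z) s (c<a ∷ z<a) = ≼-prefix (c ∷ []) (rise a z s z<a) ◅◅ (ascent [] (z ++ s) c<a ◅ ε)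

pick : ∀ {a z u} → u ↭ a ∷ z → Σ (List ℕ) λ pre → Σ (List ℕ) λ suf → u ≡ pre ++ a ∷ suf × pre ++ suf ↭ z
pick {a} u↭ with ∈-∃++ (∈-resp-↭ (↭-sym u↭) (here refl))
... | pre , suf , refl = pre , suf , refl , drop-mid pre [] u↭

increasing-bottom : ∀ {z} → AllPairs _<_ z → ∀ {u} → u ↭ z → z ≼ u
increasing-bottom {[]}    []          u↭ rewrite ↭-empty-inv u↭ = ε
increasing-bottom {a ∷ z} (a< ∷ inc) u↭ with pick u↭
... | pre , suf , refl , rest↭ =
  ≼-prefix (a ∷ []) (increasing-bottom inc rest↭) ◅◅ sink a pre suf a<pre
  where
  a<pre : All (a <_) pre
  a<pre = All.tabulate λ c∈ → All.lookup a< (∈-resp-↭ rest↭ (∈-++⁺ˡ c∈))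

decreasing-top : ∀ {z} → AllPairs _>_ z → ∀ {u} → u ↭ z → u ≼ z
decreasing-top {[]}    []          u↭ rewrite ↭-empty-inv u↭ = ε
decreasing-top {a ∷ z} (a> ∷ dec) u↭ with pick u↭
... | pre , suf , refl , rest↭ =
  rise a pre suf pre<a ◅◅ ≼-prefix (a ∷ []) (decreasing-top dec rest↭)
  where
  pre<a : All (_< a) pre
  pre<a = All.tabulate λ c∈ → All.lookup a> (∈-resp-↭ rest↭ (∈-++⁺ˡ c∈))

range-increasing : ∀ n → AllPairs _<_ (range n)
range-increasing n = AllPairs.map⁺ (AllPairs.applyUpTo⁺₁ id n (λ i<j _ → s<s i<j))

w₀-decreasing : ∀ n → AllPairs _>_ (w₀ n)
w₀-decreasing n = subst (AllPairs _>_) w₀≡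
  (AllPairs.map⁺ (AllPairs.applyDownFrom⁺₁ id n (λ j<i _ → s<s j<i)))
  where
  w₀≡ : map suc (downFrom n) ≡ w₀ n
  w₀≡ = trans (cong (map suc) (sym (reverse-upTo n))) (reverse-map suc (upTo n))

module _ {P : ℕ → Set} (P? : Decidable P) where

  ≼-filter-pair : ∀ {x y} → x < y →
    filter P? (x ∷ []) ++ filter P? (y ∷ []) ≼ filter P? (y ∷ []) ++ filter P? (x ∷ [])
  ≼-filter-pair {x} {y} x<y with P? x | P? y
  ... | yes _ | yes _ = ascent [] [] x<y ◅ ε
  ... | yes _ | no  _ = ε
  ... | no  _ | yes _ = ε
  ... | no  _ | no  _ = ε

  filter-around : ∀ p x y s →
    filter P? (p ++ x ∷ y ∷ s) ≡ filter P? p ++ (filter P? (x ∷ []) ++ filter P? (y ∷ [])) ++ filter P? s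
  filter-around p x y s = begin
    filter P? (p ++ x ∷ y ∷ s)                                             ≡⟨ filter-++ P? p _ ⟩
    filter P? p ++ filter P? (x ∷ y ∷ s)                                   ≡⟨ cong (filter P? p ++_) (filter-++ P? (x ∷ []) (y ∷ s)) ⟩
    filter P? p ++ filter P? (x ∷ []) ++ filter P? (y ∷ s)                 ≡⟨ cong (λ w → filter P? p ++ filter P? (x ∷ []) ++ w) (filter-++ P? (y ∷ []) s) ⟩
    filter P? p ++ filter P? (x ∷ []) ++ filter P? (y ∷ []) ++ filter P? s ≡⟨ cong (filter P? p ++_) (sym (++-assoc (filter P? (x ∷ [])) _ _)) ⟩
    filter P? p ++ (filter P? (x ∷ []) ++ filter P? (y ∷ [])) ++ filter P? s ∎
    where open ≡-Reasoning

  ≼-filter : ∀ {u v} → u ≼ v → filter P? u ≼ filter P? v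
  ≼-filter ε = ε
  ≼-filter (ascent p {x} {y} s x<y ◅ r) =
    subst₂ _≼_ (sym (filter-around p x y s)) (sym (filter-around p y x s))
      (≼-prefix (filter P? p) (≼-suffix (filter P? s) (≼-filter-pair x<y)))
    ◅◅ ≼-filter r

≪⇒disjoint : ∀ {x y} → x ≪ y → Disjoint x y
≪⇒disjoint x≪y (a∈x , a∈y) = <-irrefl refl (x≪y a∈x a∈y)

≫⇒disjoint : ∀ {x y} → y ≪ x → Disjoint x y
≫⇒disjoint y≪x (a∈x , a∈y) = <-irrefl refl (y≪x a∈y a∈x)

≪-resp-↭ : ∀ {x y x′ y′} → x′ ↭ x → y′ ↭ y → x ≪ y → x′ ≪ y′
≪-resp-↭ x′↭x y′↭y x≪y a∈ b∈ = x≪y (∈-resp-↭ x′↭x a∈) (∈-resp-↭ y′↭y b∈)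

disjoint-resp-↭ : ∀ {x y x′ y′ : List ℕ} → x′ ↭ x → y′ ↭ y → Disjoint x y → Disjoint x′ y′
disjoint-resp-↭ x′↭x y′↭y x⊥y (a∈x′ , a∈y′) = x⊥y (∈-resp-↭ x′↭x a∈x′ , ∈-resp-↭ y′↭y a∈y′)

concat-interleaving : ∀ a b → Interleaving a b (a ++ b)
concat-interleaving []      []      = []
concat-interleaving []      (d ∷ b) = consʳ (concat-interleaving [] b)
concat-interleaving (c ∷ a) b       = consˡ (concat-interleaving a b)

module _ {P : ℕ → Set} (P? : Decidable P) where

  filter-interleavingˡ : ∀ {a b s} → All P a → All (λ c → ¬ P c) b → Interleaving a b s → filter P? s ≡ a
  filter-interleavingˡ []        []        []          = refl
  filter-interleavingˡ (pc ∷ pa) nb        (consˡ sp) = trans (filter-accept P? pc) (cong (_ ∷_) (filter-interleavingˡ pa nb sp))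
  filter-interleavingˡ pa        (nd ∷ nb) (consʳ sp) = trans (filter-reject P? nd) (filter-interleavingˡ pa nb sp)

  filter-interleavingʳ : ∀ {a b s} → All (λ c → ¬ P c) a → All P b → Interleaving a b s → filter P? s ≡ b
  filter-interleavingʳ na pb sp = filter-interleavingˡ pb na (swap sp)

interleaving-filter : ∀ {P Q : ℕ → Set} (P? : Decidable P) (Q? : Decidable Q) → (∀ {c} → P c → ¬ Q c) →
  ∀ {s} → All (λ c → P c ⊎ Q c) s → Interleaving (filter P? s) (filter Q? s) s
interleaving-filter P? Q? P⇒¬Q {[]}    []             = []
interleaving-filter P? Q? P⇒¬Q {c ∷ s} (inj₁ pc ∷ pq)
  rewrite filter-accept P? {c} {s} pc | filter-reject Q? {c} {s} (P⇒¬Q pc) =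
  consˡ (interleaving-filter P? Q? P⇒¬Q pq)
interleaving-filter P? Q? P⇒¬Q {c ∷ s} (inj₂ qc ∷ pq)
  rewrite filter-reject P? {c} {s} (λ pc → P⇒¬Q pc qc) | filter-accept Q? {c} {s} qc =
  consʳ (interleaving-filter P? Q? P⇒¬Q pq)

interleaving-≼ : ∀ {a b s} → b ≪ a → Interleaving a b s → s ≼ a ++ b
interleaving-≼ b≪a []                                       = ε
interleaving-≼ {c ∷ a} b≪a (consˡ sp)                       =
  ≼-prefix (c ∷ []) (interleaving-≼ (λ d∈ c∈ → b≪a d∈ (there c∈)) sp)
interleaving-≼ {a} {d ∷ b} b≪a (consʳ sp)                   =
  ≼-prefix (d ∷ []) (interleaving-≼ (λ d∈ c∈ → b≪a (there d∈) c∈) sp) ◅◅ sink d a b (All.tabulate (b≪a (here refl)))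

≼-interleaving : ∀ {a b s} → b ≪ a → Interleaving a b s → b ++ a ≼ s
≼-interleaving b≪a []                                       = ε
≼-interleaving {c ∷ a} {b} b≪a (consˡ sp)                   =
  rise c b a (All.tabulate (λ d∈ → b≪a d∈ (here refl))) ◅◅ ≼-prefix (c ∷ []) (≼-interleaving (λ d∈ c∈ → b≪a d∈ (there c∈)) sp)
≼-interleaving {a} {d ∷ b} b≪a (consʳ sp)                   =
  ≼-prefix (d ∷ []) (≼-interleaving (λ d∈ c∈ → b≪a (there d∈) c∈) sp)

interleaving-inv : ∀ {a b s} → b ≪ a → Interleaving a b s → inv a + inv b ≤ inv s
interleaving-inv {a} {b} b≪a sp =
  subst (_≤ _) (trans (inv-++-≪ b a b≪a) (+-comm (inv b) (inv a))) (≼-inv (≼-interleaving b≪a sp))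

restrict : List ℕ → List ℕ → List ℕ
restrict x = filter (_∈? x)

restrict-interleaving : ∀ {x y a b s} → Disjoint x y → a ↭ x → b ↭ y → Interleaving a b s →
  restrict x s ≡ a × restrict y s ≡ b
restrict-interleaving {x} {y} x⊥y a↭x b↭y sp =
  filter-interleavingˡ (_∈? x) (All.tabulate (∈-resp-↭ a↭x)) (All.tabulate λ c∈b c∈x → x⊥y (c∈x , ∈-resp-↭ b↭y c∈b)) sp ,
  filter-interleavingʳ (_∈? y) (All.tabulate λ c∈a c∈y → x⊥y (∈-resp-↭ a↭x c∈a , c∈y)) (All.tabulate (∈-resp-↭ b↭y)) sp

restrict-concat : ∀ {x y} → Disjoint x y → restrict x (x ++ y) ≡ x × restrict y (x ++ y) ≡ y
restrict-concat x⊥y = restrict-interleaving x⊥y ↭-refl ↭-refl (concat-interleaving _ _)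

restrict-below : ∀ {x y u} → Disjoint x y → u ≼ x ++ y → restrict x u ≼ x × restrict y u ≼ y
restrict-below {x} {y} {u} x⊥y u≼ =
  subst (restrict x u ≼_) (proj₁ (restrict-concat x⊥y)) (≼-filter (_∈? x) u≼) ,
  subst (restrict y u ≼_) (proj₂ (restrict-concat x⊥y)) (≼-filter (_∈? y) u≼)

restrict-above : ∀ {x y v} → Disjoint x y → x ++ y ≼ v → x ≼ restrict x v × y ≼ restrict y v
restrict-above {x} {y} {v} x⊥y ≼v =
  subst (_≼ restrict x v) (proj₁ (restrict-concat x⊥y)) (≼-filter (_∈? x) ≼v) ,
  subst (_≼ restrict y v) (proj₂ (restrict-concat x⊥y)) (≼-filter (_∈? y) ≼v)

interleaving-restrict : ∀ {x y u} → Disjoint x y → u ↭ x ++ y → Interleaving (restrict x u) (restrict y u) u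
interleaving-restrict {x} {y} x⊥y u↭ =
  interleaving-filter (_∈? x) (_∈? y) (λ a∈x a∈y → x⊥y (a∈x , a∈y))
    (All.tabulate λ a∈u → ∈-++⁻ x (∈-resp-↭ u↭ a∈u))

data Blocks (P Q : ℕ → Set) : List ℕ → Set where
  first  : ∀ {c w} → P c → Blocks P Q w → Blocks P Q (c ∷ w)
  second : ∀ {w} → All Q w → Blocks P Q w

module _ {P Q : ℕ → Set} where

  blocks-concat : ∀ {x y} → All P x → All Q y → Blocks P Q (x ++ y)
  blocks-concat []        qy = second qy
  blocks-concat (pc ∷ px) qy = first pc (blocks-concat px qy)

  blocks-exchange : ∀ p c d s → Blocks P Q (p ++ c ∷ d ∷ s) → ¬ (P c × Q d) → Blocks P Q (p ++ d ∷ c ∷ s)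
  blocks-exchange []      c d s (first pc (first pd b))     _   = first pd (first pc b)
  blocks-exchange []      c d s (first pc (second (qd ∷ _))) ¬pq = ⊥-elim (¬pq (pc , qd))
  blocks-exchange []      c d s (second (qc ∷ qd ∷ qs))     _   = second (qd ∷ qc ∷ qs)
  blocks-exchange (e ∷ p) c d s (first pe b)                ¬pq = first pe (blocks-exchange p c d s b ¬pq)
  blocks-exchange (e ∷ p) c d s (second (qe ∷ qs))          ¬pq = second (qe ∷ blocks-exchange-all p qs)
    where
    blocks-exchange-all : ∀ p → All Q (p ++ c ∷ d ∷ s) → All Q (p ++ d ∷ c ∷ s)
    blocks-exchange-all []      (qc ∷ qd ∷ qs) = qd ∷ qc ∷ qs
    blocks-exchange-all (f ∷ p) (qf ∷ qs)      = qf ∷ blocks-exchange-all p qs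

  blocks-down : (∀ {a b} → P a → Q b → a < b) → ∀ {u v} → u ≼ v → Blocks P Q v → Blocks P Q u
  blocks-down P<Q ε                          b = b
  blocks-down P<Q (ascent p {x} {y} s x<y ◅ r) b =
    blocks-exchange p y x s (blocks-down P<Q r b) λ (py , qx) → <-asym x<y (P<Q py qx)

  blocks-up : (∀ {a b} → P a → Q b → b < a) → ∀ {u v} → u ≼ v → Blocks P Q u → Blocks P Q v
  blocks-up P>Q ε                          b = b
  blocks-up P>Q (ascent p {x} {y} s x<y ◅ r) b =
    blocks-up P>Q r (blocks-exchange p x y s b λ (px , qy) → <-asym x<y (P>Q px qy))

  blocks-split : (P? : Decidable P) (Q? : Decidable Q) → (∀ {c} → P c → ¬ Q c) →
    ∀ {w} → Blocks P Q w → w ≡ filter P? w ++ filter Q? w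
  blocks-split P? Q? P⇒¬Q (first {c} {w} pc b)
    rewrite filter-accept P? {c} {w} pc | filter-reject Q? {c} {w} (P⇒¬Q pc) =
    cong (c ∷_) (blocks-split P? Q? P⇒¬Q b)
  blocks-split P? Q? P⇒¬Q (second qw) =
    sym (cong₂ _++_ (filter-none P? (All.map (λ qc pc → P⇒¬Q pc qc) qw)) (filter-all Q? qw))

below-direct : ∀ {x y u} → x ≪ y → u ≼ x ++ y → u ≡ restrict x u ++ restrict y u
below-direct {x} {y} x≪y u≼ =
  blocks-split (_∈? x) (_∈? y) (λ a∈x a∈y → ≪⇒disjoint x≪y (a∈x , a∈y))
    (blocks-down x≪y u≼ (blocks-concat (All.tabulate id) (All.tabulate id)))

above-skew : ∀ {x y v} → y ≪ x → x ++ y ≼ v → v ≡ restrict x v ++ restrict y v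
above-skew {x} {y} y≪x ≼v =
  blocks-split (_∈? x) (_∈? y) (λ a∈x a∈y → ≫⇒disjoint y≪x (a∈x , a∈y))
    (blocks-up (λ a∈x b∈y → y≪x b∈y a∈x) ≼v (blocks-concat (All.tabulate id) (All.tabulate id)))

shuffles : List ℕ → List ℕ → List (List ℕ)
shuffles []      []      = [] ∷ []
shuffles []      (d ∷ b) = map (d ∷_) (shuffles [] b)
shuffles (c ∷ a) []      = map (c ∷_) (shuffles a [])
shuffles (c ∷ a) (d ∷ b) = map (c ∷_) (shuffles a (d ∷ b)) ++ map (d ∷_) (shuffles (c ∷ a) b)

∈-shuffles⁺ : ∀ {a b s} → Interleaving a b s → s ∈ shuffles a b
∈-shuffles⁺ []                              = here refl
∈-shuffles⁺ {c ∷ a} {[]}    (consˡ sp)      = ∈-map⁺ (c ∷_) (∈-shuffles⁺ sp)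
∈-shuffles⁺ {c ∷ a} {d ∷ b} (consˡ sp)      = ∈-++⁺ˡ (∈-map⁺ (c ∷_) (∈-shuffles⁺ sp))
∈-shuffles⁺ {[]}    {d ∷ b} (consʳ sp)      = ∈-map⁺ (d ∷_) (∈-shuffles⁺ sp)
∈-shuffles⁺ {c ∷ a} {d ∷ b} (consʳ sp)      = ∈-++⁺ʳ _ (∈-map⁺ (d ∷_) (∈-shuffles⁺ sp))

∈-shuffles⁻ : ∀ a b {s} → s ∈ shuffles a b → Interleaving a b s
∈-shuffles⁻ []      []      (here refl) = []
∈-shuffles⁻ []      (d ∷ b) s∈ with ∈-map⁻ (d ∷_) s∈
... | _ , s∈′ , refl = consʳ (∈-shuffles⁻ [] b s∈′)
∈-shuffles⁻ (c ∷ a) []      s∈ with ∈-map⁻ (c ∷_) s∈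
... | _ , s∈′ , refl = consˡ (∈-shuffles⁻ a [] s∈′)
∈-shuffles⁻ (c ∷ a) (d ∷ b) s∈ with ∈-++⁻ (map (c ∷_) (shuffles a (d ∷ b))) s∈
... | inj₁ s∈ˡ with ∈-map⁻ (c ∷_) s∈ˡ
...   | _ , s∈′ , refl = consˡ (∈-shuffles⁻ a (d ∷ b) s∈′)
∈-shuffles⁻ (c ∷ a) (d ∷ b) s∈ | inj₂ s∈ʳ with ∈-map⁻ (d ∷_) s∈ʳ
...   | _ , s∈′ , refl = consʳ (∈-shuffles⁻ (c ∷ a) b s∈′)

shuffles-unique : ∀ a b → Disjoint a b → Unique (shuffles a b)
shuffles-unique []      []      a⊥b = All.[] ∷ []
shuffles-unique []      (d ∷ b) a⊥b = Unique.map⁺ ∷-injectiveʳ (shuffles-unique [] b (λ ()))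
shuffles-unique (c ∷ a) []      a⊥b = Unique.map⁺ ∷-injectiveʳ (shuffles-unique a [] (λ ()))
shuffles-unique (c ∷ a) (d ∷ b) a⊥b =
  Unique.++⁺ (Unique.map⁺ ∷-injectiveʳ (shuffles-unique a (d ∷ b) λ (e∈a , e∈db) → a⊥b (there e∈a , e∈db)))
             (Unique.map⁺ ∷-injectiveʳ (shuffles-unique (c ∷ a) b λ (e∈ca , e∈b) → a⊥b (e∈ca , there e∈b)))
             λ (s∈ˡ , s∈ʳ) → different-heads s∈ˡ s∈ʳ
  where
  different-heads : ∀ {s} → s ∈ map (c ∷_) (shuffles a (d ∷ b)) → s ∈ map (d ∷_) (shuffles (c ∷ a) b) → ⊥
  different-heads s∈ˡ s∈ʳ with ∈-map⁻ (c ∷_) s∈ˡ | ∈-map⁻ (d ∷_) s∈ʳ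
  ... | _ , _ , refl | _ , _ , e = a⊥b (here refl , here (∷-injectiveˡ e))

combine : (List ℕ → List ℕ → List (List ℕ)) → List (List ℕ) → List (List ℕ) → List (List ℕ)
combine join A B = concatMap (λ a → concatMap (join a) B) A

module _ (join : List ℕ → List ℕ → List (List ℕ)) {A B : List (List ℕ)} where

  ∈-combine⁺ : ∀ {a b s} → a ∈ A → b ∈ B → s ∈ join a b → s ∈ combine join A B
  ∈-combine⁺ a∈ b∈ s∈ = ∈-concatMap⁺ _ (lose a∈ (∈-concatMap⁺ (join _) (lose b∈ s∈)))

  ∈-combine⁻ : ∀ {s} → s ∈ combine join A B → Σ (List ℕ) λ a → Σ (List ℕ) λ b → a ∈ A × b ∈ B × s ∈ join a b
  ∈-combine⁻ s∈ with find (∈-concatMap⁻ _ {A} s∈)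
  ... | a , a∈ , s∈′ with find (∈-concatMap⁻ (join a) {B} s∈′)
  ...   | b , b∈ , s∈″ = a , b , a∈ , b∈ , s∈″

concatMap-unique : ∀ (f : List ℕ → List (List ℕ)) (h : List ℕ → List ℕ) {xs} → Unique xs →
  (∀ {x} → x ∈ xs → Unique (f x)) → (∀ {x y} → x ∈ xs → y ∈ f x → h y ≡ x) → Unique (concatMap f xs)
concatMap-unique f h {[]}     []           _    _    = []
concatMap-unique f h {x ∷ xs} (x∉xs ∷ uxs) uf   back =
  Unique.++⁺ (uf (here refl)) (concatMap-unique f h uxs (uf ∘ there) (back ∘ there))
    λ (y∈fx , y∈rest) → disjoint y∈fx y∈rest
  where
  disjoint : ∀ {y} → y ∈ f x → y ∈ concatMap f xs → ⊥
  disjoint y∈fx y∈rest with find (∈-concatMap⁻ f {xs} y∈rest)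
  ... | x′ , x′∈ , y∈fx′ = All.lookup x∉xs x′∈ (trans (sym (back (here refl) y∈fx)) (back (there x′∈) y∈fx′))

combine-unique : ∀ (join : List ℕ → List ℕ → List (List ℕ)) (πA πB : List ℕ → List ℕ) {A B} →
  Unique A → Unique B → (∀ {a b} → a ∈ A → b ∈ B → Unique (join a b)) →
  (∀ {a b s} → a ∈ A → b ∈ B → s ∈ join a b → πA s ≡ a × πB s ≡ b) → Unique (combine join A B)
combine-unique join πA πB {A} {B} uA uB ujoin proj =
  concatMap-unique _ πA uA
    (λ a∈ → concatMap-unique (join _) πB uB (ujoin a∈) (λ b∈ s∈ → proj₂ (proj a∈ b∈ s∈)))
    (λ a∈ s∈ → let (b , b∈ , s∈′) = find (∈-concatMap⁻ (join _) {B} s∈) in proj₁ (proj a∈ b∈ s∈′))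

sumOver : (List ℕ → ℕ) → List (List ℕ) → ℕ
sumOver f ws = sum (map f ws)

sumOver-++ : ∀ f xs ys → sumOver f (xs ++ ys) ≡ sumOver f xs + sumOver f ys
sumOver-++ f []       ys = refl
sumOver-++ f (x ∷ xs) ys = trans (cong (f x +_) (sumOver-++ f xs ys)) (sym (+-assoc (f x) _ _))

sumOver-map : ∀ f h ws → sumOver f (map h ws) ≡ sumOver (λ w → f (h w)) ws
sumOver-map f h []       = refl
sumOver-map f h (w ∷ ws) = cong (f (h w) +_) (sumOver-map f h ws)

sumOver-cong : ∀ {f g} ws → (∀ {w} → w ∈ ws → f w ≡ g w) → sumOver f ws ≡ sumOver g ws
sumOver-cong []       f≡g = refl
sumOver-cong (w ∷ ws) f≡g = cong₂ _+_ (f≡g (here refl)) (sumOver-cong ws (f≡g ∘ there))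

sumOver-*ˡ : ∀ k f ws → sumOver (λ w → k * f w) ws ≡ k * sumOver f ws
sumOver-*ˡ k f []       = sym (*-zeroʳ k)
sumOver-*ˡ k f (w ∷ ws) = trans (cong (k * f w +_) (sumOver-*ˡ k f ws)) (sym (*-distribˡ-+ k (f w) _))

sumOver-*ʳ : ∀ k f ws → sumOver (λ w → f w * k) ws ≡ sumOver f ws * k
sumOver-*ʳ k f []       = refl
sumOver-*ʳ k f (w ∷ ws) = trans (cong (f w * k +_) (sumOver-*ʳ k f ws)) (sym (*-distribʳ-+ k (f w) _))

sumOver-concatMap : ∀ g (f : List ℕ → List (List ℕ)) xs → sumOver g (concatMap f xs) ≡ sumOver (λ x → sumOver g (f x)) xs
sumOver-concatMap g f []       = refl
sumOver-concatMap g f (x ∷ xs) = trans (sumOver-++ g (f x) _) (cong (sumOver g (f x) +_) (sumOver-concatMap g f xs))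

sumOver-combine : ∀ (join : List ℕ → List ℕ → List (List ℕ)) (g gA gB : List ℕ → ℕ) (w : ℕ) A B →
  (∀ {a b} → a ∈ A → b ∈ B → sumOver g (join a b) ≡ gA a * gB b * w) →
  sumOver g (combine join A B) ≡ sumOver gA A * sumOver gB B * w
sumOver-combine join g gA gB w A B factor = begin
  sumOver g (combine join A B)                                 ≡⟨ sumOver-concatMap g _ A ⟩
  sumOver (λ a → sumOver g (concatMap (join a) B)) A           ≡⟨ sumOver-cong A (λ a∈ → trans (sumOver-concatMap g (join _) B) (sumOver-cong B (factor a∈))) ⟩
  sumOver (λ a → sumOver (λ b → gA a * gB b * w) B) A          ≡⟨ sumOver-cong A (λ {a} _ → inner a) ⟩
  sumOver (λ a → gA a * sumOver gB B * w) A                    ≡⟨ sumOver-*ʳ w (λ a → gA a * sumOver gB B) A ⟩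
  sumOver (λ a → gA a * sumOver gB B) A * w                    ≡⟨ cong (_* w) (sumOver-*ʳ (sumOver gB B) gA A) ⟩
  sumOver gA A * sumOver gB B * w                              ∎
  where
  open ≡-Reasoning
  inner : ∀ a → sumOver (λ b → gA a * gB b * w) B ≡ gA a * sumOver gB B * w
  inner a = trans (sumOver-*ʳ w (λ b → gA a * gB b) B) (cong (_* w) (sumOver-*ˡ (gA a) gB B))

-- The Gaussian binomial coefficient [m+k choose m] at q, by the q-Pascal rule.
gauss : ℕ → ℕ → ℕ → ℕ
gauss q zero    k       = 1
gauss q (suc m) zero    = 1
gauss q (suc m) (suc k) = q ^ suc k * gauss q m (suc k) + gauss q (suc m) k

gauss-zeroʳ : ∀ q m → gauss q m 0 ≡ 1
gauss-zeroʳ q zero    = refl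
gauss-zeroʳ q (suc m) = refl

-- How far an interleaving of a and b is above b ++ a, measured in the exponent of q.
excess : List ℕ → List ℕ → List ℕ → ℕ
excess a b s = inv s ∸ (inv a + inv b)

excess-left : ∀ {c a b s} → b ≪ c ∷ a → Interleaving a b s →
  excess (c ∷ a) b (c ∷ s) ≡ length b + excess a b s
excess-left {c} {a} {b} {s} b≪ca sp = begin
  countSmaller c s + inv s ∸ (countSmaller c a + inv a + inv b)
    ≡⟨ cong₂ (λ k l → k + inv s ∸ l) front (+-assoc (countSmaller c a) (inv a) (inv b)) ⟩
  countSmaller c a + length b + inv s ∸ (countSmaller c a + (inv a + inv b))
    ≡⟨ cong (_∸ (countSmaller c a + (inv a + inv b))) (+-assoc (countSmaller c a) (length b) (inv s)) ⟩
  countSmaller c a + (length b + inv s) ∸ (countSmaller c a + (inv a + inv b))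
    ≡⟨ [m+n]∸[m+o]≡n∸o (countSmaller c a) _ _ ⟩
  length b + inv s ∸ (inv a + inv b)
    ≡⟨ +-∸-assoc (length b) (interleaving-inv (λ d∈ c∈ → b≪ca d∈ (there c∈)) sp) ⟩
  length b + excess a b s ∎
  where
  open ≡-Reasoning
  front : countSmaller c s ≡ countSmaller c a + length b
  front = trans (countSmaller-↭ c (toPermutation sp))
    (trans (countSmaller-++ c a b) (cong (countSmaller c a +_) (countSmaller-below c b (All.tabulate λ d∈ → b≪ca d∈ (here refl)))))

excess-right : ∀ {d a b s} → d ∷ b ≪ a → Interleaving a b s →
  excess a (d ∷ b) (d ∷ s) ≡ excess a b s
excess-right {d} {a} {b} {s} db≪a sp = begin
  countSmaller d s + inv s ∸ (inv a + (countSmaller d b + inv b))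
    ≡⟨ cong₂ (λ k l → k + inv s ∸ l) front (exchange (inv a) (countSmaller d b) (inv b)) ⟩
  countSmaller d b + inv s ∸ (countSmaller d b + (inv a + inv b))
    ≡⟨ [m+n]∸[m+o]≡n∸o (countSmaller d b) _ _ ⟩
  excess a b s ∎
  where
  open ≡-Reasoning
  exchange : ∀ i j k → i + (j + k) ≡ j + (i + k)
  exchange = solve-∀
  front : countSmaller d s ≡ countSmaller d b
  front = trans (countSmaller-↭ d (toPermutation sp))
    (trans (countSmaller-++ d a b) (cong (_+ countSmaller d b) (countSmaller-above d a (All.tabulate (db≪a (here refl))))))

module _ (q : ℕ) where

  shuffleWeight : List ℕ → List ℕ → List ℕ → ℕ
  shuffleWeight a b s = q ^ excess a b s

  private
    front-left : ∀ c a b → b ≪ c ∷ a →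
      sumOver (shuffleWeight (c ∷ a) b) (map (c ∷_) (shuffles a b)) ≡ q ^ length b * sumOver (shuffleWeight a b) (shuffles a b)
    front-left c a b b≪ca =
      trans (sumOver-map _ (c ∷_) (shuffles a b))
        (trans (sumOver-cong (shuffles a b) λ s∈ →
                  trans (cong (q ^_) (excess-left b≪ca (∈-shuffles⁻ a b s∈))) (^-distribˡ-+-* q (length b) _))
               (sumOver-*ˡ (q ^ length b) (shuffleWeight a b) (shuffles a b)))

    front-right : ∀ d a b → d ∷ b ≪ a →
      sumOver (shuffleWeight a (d ∷ b)) (map (d ∷_) (shuffles a b)) ≡ sumOver (shuffleWeight a b) (shuffles a b)
    front-right d a b db≪a =
      trans (sumOver-map _ (d ∷_) (shuffles a b))
        (sumOver-cong (shuffles a b) λ s∈ → cong (q ^_) (excess-right db≪a (∈-shuffles⁻ a b s∈)))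

  shuffle-sum : ∀ a b → b ≪ a → sumOver (shuffleWeight a b) (shuffles a b) ≡ gauss q (length a) (length b)
  shuffle-sum []      []      b≪a = refl
  shuffle-sum []      (d ∷ b) b≪a = trans (front-right d [] b λ _ ()) (shuffle-sum [] b λ _ ())
  shuffle-sum (c ∷ a) []      b≪a =
    trans (front-left c a [] b≪a) (trans (+-identityʳ _) (trans (shuffle-sum a [] λ ()) (gauss-zeroʳ q (length a))))
  shuffle-sum (c ∷ a) (d ∷ b) b≪a =
    trans (sumOver-++ _ (map (c ∷_) (shuffles a (d ∷ b))) _)
      (cong₂ _+_ (trans (front-left c a (d ∷ b) b≪a) (cong (q ^ suc (length b) *_) (shuffle-sum a (d ∷ b) λ e∈ c∈ → b≪a e∈ (there c∈))))
                 (trans (front-right d (c ∷ a) b b≪a) (shuffle-sum (c ∷ a) b λ e∈ → b≪a (there e∈))))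

  qint-suc : ∀ i → qint q (suc i) ≡ qint q i + q ^ i
  qint-suc i = begin
    sum (map (q ^_) (upTo (suc i)))             ≡⟨ cong (sum ∘ map (q ^_)) (sym (upTo-∷ʳ i)) ⟩
    sum (map (q ^_) (upTo i ++ i ∷ []))         ≡⟨ cong sum (map-++ (q ^_) (upTo i) (i ∷ [])) ⟩
    sum (map (q ^_) (upTo i) ++ q ^ i ∷ [])     ≡⟨ sum-++ (map (q ^_) (upTo i)) (q ^ i ∷ []) ⟩
    qint q i + (q ^ i + 0)                      ≡⟨ cong (qint q i +_) (+-identityʳ (q ^ i)) ⟩
    qint q i + q ^ i                            ∎
    where open ≡-Reasoning

  qfact-suc : ∀ k → qfact q (suc k) ≡ qfact q k * qint q (suc k)
  qfact-suc k = begin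
    product (map [_+1] (upTo (suc k)))              ≡⟨ cong (product ∘ map [_+1]) (sym (upTo-∷ʳ k)) ⟩
    product (map [_+1] (upTo k ++ k ∷ []))          ≡⟨ cong product (map-++ [_+1] (upTo k) (k ∷ [])) ⟩
    product (map [_+1] (upTo k) ++ [ k +1] ∷ [])    ≡⟨ product-++ (map [_+1] (upTo k)) ([ k +1] ∷ []) ⟩
    qfact q k * ([ k +1] * 1)                       ≡⟨ cong (qfact q k *_) (*-identityʳ [ k +1]) ⟩
    qfact q k * qint q (suc k)                      ∎
    where
    open ≡-Reasoning
    [_+1] : ℕ → ℕ
    [ i +1] = qint q (suc i)

  qint-+ : ∀ a b → qint q (a + b) ≡ qint q b + q ^ b * qint q a
  qint-+ zero    b = sym (trans (cong (qint q b +_) (*-zeroʳ (q ^ b))) (+-identityʳ _))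
  qint-+ (suc a) b = begin
    qint q (suc (a + b))                         ≡⟨ qint-suc (a + b) ⟩
    qint q (a + b) + q ^ (a + b)                 ≡⟨ cong₂ _+_ (qint-+ a b) (^-distribˡ-+-* q a b) ⟩
    qint q b + q ^ b * qint q a + q ^ a * q ^ b  ≡⟨ regroup (qint q b) (q ^ b) (qint q a) (q ^ a) ⟩
    qint q b + q ^ b * (qint q a + q ^ a)        ≡⟨ cong (λ k → qint q b + q ^ b * k) (sym (qint-suc a)) ⟩
    qint q b + q ^ b * qint q (suc a)            ∎
    where
    open ≡-Reasoning
    regroup : ∀ x y z w → x + y * z + w * y ≡ x + y * (z + w)
    regroup = solve-∀

  gauss-qfact : ∀ m k → gauss q m k * qfact q m * qfact q k ≡ qfact q (m + k)
  gauss-qfact zero    k       = +-identityʳ (qfact q k)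
  gauss-qfact (suc m) zero    = trans (*-identityʳ _) (trans (+-identityʳ _) (cong (qfact q) (sym (+-identityʳ (suc m)))))
  gauss-qfact (suc m) (suc k) = begin
    (Q * gauss q m (suc k) + gauss q (suc m) k) * qfact q (suc m) * qfact q (suc k)
      ≡⟨ cong₂ (λ u v → (Q * gauss q m (suc k) + gauss q (suc m) k) * u * v) (qfact-suc m) (qfact-suc k) ⟩
    (Q * gauss q m (suc k) + gauss q (suc m) k) * (qfact q m * [m+1]) * (qfact q k * [k+1])
      ≡⟨ expand Q (gauss q m (suc k)) (gauss q (suc m) k) (qfact q m) (qfact q k) [m+1] [k+1] ⟩
    Q * [m+1] * (gauss q m (suc k) * qfact q m * (qfact q k * [k+1])) + [k+1] * (gauss q (suc m) k * (qfact q m * [m+1]) * qfact q k)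
      ≡⟨ cong₂ (λ u v → Q * [m+1] * u + [k+1] * v) left right ⟩
    Q * [m+1] * X + [k+1] * X
      ≡⟨ collect Q [m+1] [k+1] X ⟩
    X * ([k+1] + Q * [m+1])
      ≡⟨ cong (X *_) (sym (qint-+ (suc m) (suc k))) ⟩
    X * qint q (suc m + suc k)
      ≡⟨ cong (λ n → X * qint q n) (cong suc (+-suc m k)) ⟩
    qfact q (suc (m + k)) * qint q (suc (suc (m + k)))
      ≡⟨ sym (qfact-suc (suc (m + k))) ⟩
    qfact q (suc (suc (m + k)))
      ≡⟨ cong (qfact q ∘ suc) (sym (+-suc m k)) ⟩
    qfact q (suc m + suc k) ∎
    where
    open ≡-Reasoning
    Q = q ^ suc k
    X = qfact q (suc (m + k))
    [m+1] = qint q (suc m)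
    [k+1] = qint q (suc k)
    left : gauss q m (suc k) * qfact q m * (qfact q k * [k+1]) ≡ X
    left = trans (cong (gauss q m (suc k) * qfact q m *_) (sym (qfact-suc k)))
                 (trans (gauss-qfact m (suc k)) (cong (qfact q) (+-suc m k)))
    right : gauss q (suc m) k * (qfact q m * [m+1]) * qfact q k ≡ X
    right = trans (cong (λ u → gauss q (suc m) k * u * qfact q k) (sym (qfact-suc m))) (gauss-qfact (suc m) k)
    expand : ∀ Q G₁ G₂ Fm Fk sm sk →
      (Q * G₁ + G₂) * (Fm * sm) * (Fk * sk) ≡ Q * sm * (G₁ * Fm * (Fk * sk)) + sk * (G₂ * (Fm * sm) * Fk)
    expand = solve-∀
    collect : ∀ Q sm sk X → Q * sm * X + sk * X ≡ X * (sk + Q * sm)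
    collect = solve-∀

data Orientation (l r : Tree) : Set where
  positive : leaves l ≪ leaves r → isPos (node l r) ≡ true  → isNeg (node l r) ≡ false → Orientation l r
  negative : leaves r ≪ leaves l → isPos (node l r) ≡ false → isNeg (node l r) ≡ true  → Orientation l r

firstLeaf-∈ : ∀ t → firstLeaf t ∈ leaves t
firstLeaf-∈ (leaf a)   = here refl
firstLeaf-∈ (node l r) = ∈-++⁺ˡ (firstLeaf-∈ l)

orientation : ∀ l r → AllLess (leaves l) (leaves r) ⊎ AllLess (leaves r) (leaves l) → Orientation l r
orientation l r (inj₁ l<r) = positive l≪r (<ᵇ-true (l≪r (firstLeaf-∈ l) (firstLeaf-∈ r))) (<ᵇ-false (<⇒≯ (l≪r (firstLeaf-∈ l) (firstLeaf-∈ r))))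
  where
  l≪r : leaves l ≪ leaves r
  l≪r a∈ b∈ = All.lookup (All.lookup l<r a∈) b∈
orientation l r (inj₂ r<l) = negative r≪l (<ᵇ-false (<⇒≯ (r≪l (firstLeaf-∈ r) (firstLeaf-∈ l)))) (<ᵇ-true (r≪l (firstLeaf-∈ r) (firstLeaf-∈ l)))
  where
  r≪l : leaves r ≪ leaves l
  r≪l a∈ b∈ = All.lookup (All.lookup r<l a∈) b∈

lowerJoin : Bool → List ℕ → List ℕ → List (List ℕ)
lowerJoin true  a b = (a ++ b) ∷ []
lowerJoin false a b = shuffles a b

upperJoin : Bool → List ℕ → List ℕ → List (List ℕ)
upperJoin true  a b = shuffles b a
upperJoin false a b = (a ++ b) ∷ []

orientation-disjoint : ∀ {l r} → Orientation l r → Disjoint (leaves l) (leaves r)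
orientation-disjoint (positive l≪r _ _) = ≪⇒disjoint l≪r
orientation-disjoint (negative r≪l _ _) = ≫⇒disjoint r≪l

enum : (Bool → List ℕ → List ℕ → List (List ℕ)) → Tree → List (List ℕ)
enum J (leaf a)   = (a ∷ []) ∷ []
enum J (node l r) = combine (J (isPos (node l r))) (enum J l) (enum J r)

record IntervalKind (I : List ℕ → List ℕ → Set) : Set where
  field
    rearranges : ∀ {x u} → I x u → u ↭ x
    singleton  : ∀ {a u} → I (a ∷ []) u → u ≡ a ∷ []
    reflexive  : ∀ {x} → I x x
    restricts  : ∀ {x y u} → Disjoint x y → I (x ++ y) u → I x (restrict x u) × I y (restrict y u)

record GoodJoin (I : List ℕ → List ℕ → Set) (x y : List ℕ) (join : List ℕ → List ℕ → List (List ℕ)) : Set where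
  field
    sound       : ∀ {a b s} → I x a → I y b → s ∈ join a b → I (x ++ y) s
    complete    : ∀ {u} → I (x ++ y) u → u ∈ join (restrict x u) (restrict y u)
    interleaves : ∀ {a b s} → s ∈ join a b → Interleaving a b s
    unique      : ∀ {a b} → I x a → I y b → Unique (join a b)

module Enumeration {I} (kind : IntervalKind I) (J : Bool → List ℕ → List ℕ → List (List ℕ))
                   (good : ∀ {l r} → Orientation l r → GoodJoin I (leaves l) (leaves r) (J (isPos (node l r)))) where
  open IntervalKind kind

  ∈-enum : ∀ T → IsSepTree T → ∀ {u} → u ∈ enum J T ⇔ I (leaves T) u
  ∈-enum (leaf a) _ = mk⇔ (λ { (here refl) → reflexive }) (λ Iu → here (singleton Iu))
  ∈-enum (node l r) (sl , sr , side) {u} = mk⇔ to from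
    where
    o = orientation l r side
    open GoodJoin (good o)
    x⊥y = orientation-disjoint o
    to : u ∈ enum J (node l r) → I (leaves (node l r)) u
    to u∈ with ∈-combine⁻ _ u∈
    ... | a , b , a∈ , b∈ , u∈ab = sound (Equivalence.to (∈-enum l sl) a∈) (Equivalence.to (∈-enum r sr) b∈) u∈ab
    from : I (leaves (node l r)) u → u ∈ enum J (node l r)
    from Iu = ∈-combine⁺ _ (Equivalence.from (∈-enum l sl) (proj₁ (restricts x⊥y Iu)))
                           (Equivalence.from (∈-enum r sr) (proj₂ (restricts x⊥y Iu))) (complete Iu)

  enum-member : ∀ T → IsSepTree T → ∀ {u} → u ∈ enum J T → I (leaves T) u
  enum-member T sT = Equivalence.to (∈-enum T sT)

  enum-unique : ∀ T → IsSepTree T → Unique (enum J T)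
  enum-unique (leaf a) _ = All.[] ∷ []
  enum-unique (node l r) (sl , sr , side) =
    combine-unique _ (restrict (leaves l)) (restrict (leaves r)) (enum-unique l sl) (enum-unique r sr)
      (λ a∈ b∈ → unique (enum-member l sl a∈) (enum-member r sr b∈))
      (λ a∈ b∈ s∈ → restrict-interleaving x⊥y (rearranges (enum-member l sl a∈)) (rearranges (enum-member r sr b∈)) (interleaves s∈))
    where
    o = orientation l r side
    open GoodJoin (good o)
    x⊥y = orientation-disjoint o

Below Above : List ℕ → List ℕ → Set
Below x u = u ≼ x
Above x v = x ≼ v

below-kind : IntervalKind Below
below-kind = record
  { rearranges = ≼-↭ ; singleton = singleton-below ; reflexive = ε ; restricts = restrict-below }

above-kind : IntervalKind Above
above-kind = record
  { rearranges = λ x≼v → ↭-sym (≼-↭ x≼v) ; singleton = singleton-above ; reflexive = ε ; restricts = restrict-above }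

concat-join : ∀ {a b s} → s ∈ (a ++ b) ∷ [] → Interleaving a b s
concat-join (here refl) = concat-interleaving _ _

lower-direct : ∀ {x y} → x ≪ y → GoodJoin Below x y (lowerJoin true)
lower-direct x≪y = record
  { sound       = λ { a≼x b≼y (here refl) → ≼-++ a≼x b≼y }
  ; complete    = λ u≼ → here (below-direct x≪y u≼)
  ; interleaves = concat-join
  ; unique      = λ _ _ → All.[] ∷ []
  }

lower-skew : ∀ {x y} → y ≪ x → GoodJoin Below x y (lowerJoin false)
lower-skew y≪x = record
  { sound       = λ {a} {b} a≼x b≼y s∈ →
      interleaving-≼ (≪-resp-↭ (≼-↭ b≼y) (≼-↭ a≼x) y≪x) (∈-shuffles⁻ a b s∈) ◅◅ ≼-++ a≼x b≼y
  ; complete    = λ u≼ → ∈-shuffles⁺ (interleaving-restrict (≫⇒disjoint y≪x) (≼-↭ u≼))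
  ; interleaves = ∈-shuffles⁻ _ _
  ; unique      = λ {a} {b} a≼x b≼y → shuffles-unique a b (disjoint-resp-↭ (≼-↭ a≼x) (≼-↭ b≼y) (≫⇒disjoint y≪x))
  }

upper-skew : ∀ {x y} → y ≪ x → GoodJoin Above x y (upperJoin false)
upper-skew y≪x = record
  { sound       = λ { x≼a y≼b (here refl) → ≼-++ x≼a y≼b }
  ; complete    = λ ≼v → here (above-skew y≪x ≼v)
  ; interleaves = concat-join
  ; unique      = λ _ _ → All.[] ∷ []
  }

upper-direct : ∀ {x y} → x ≪ y → GoodJoin Above x y (upperJoin true)
upper-direct x≪y = record
  { sound       = λ {a} {b} x≼a y≼b s∈ →
      ≼-++ x≼a y≼b ◅◅ ≼-interleaving (≪-resp-↭ (↭-sym (≼-↭ x≼a)) (↭-sym (≼-↭ y≼b)) x≪y) (∈-shuffles⁻ b a s∈)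
  ; complete    = λ ≼v → ∈-shuffles⁺ (swap (interleaving-restrict (≪⇒disjoint x≪y) (↭-sym (≼-↭ ≼v))))
  ; interleaves = λ {a} {b} s∈ → swap (∈-shuffles⁻ b a s∈)
  ; unique      = λ {a} {b} x≼a y≼b →
      shuffles-unique b a (disjoint-resp-↭ (↭-sym (≼-↭ y≼b)) (↭-sym (≼-↭ x≼a)) (≫⇒disjoint x≪y))
  }

lower-good : ∀ {l r} → Orientation l r → GoodJoin Below (leaves l) (leaves r) (lowerJoin (isPos (node l r)))
lower-good {l} {r} (positive l≪r pos _) = subst (λ b → GoodJoin Below (leaves l) (leaves r) (lowerJoin b)) (sym pos) (lower-direct l≪r)
lower-good {l} {r} (negative r≪l pos _) = subst (λ b → GoodJoin Below (leaves l) (leaves r) (lowerJoin b)) (sym pos) (lower-skew r≪l)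

upper-good : ∀ {l r} → Orientation l r → GoodJoin Above (leaves l) (leaves r) (upperJoin (isPos (node l r)))
upper-good {l} {r} (positive l≪r pos _) = subst (λ b → GoodJoin Above (leaves l) (leaves r) (upperJoin b)) (sym pos) (upper-direct l≪r)
upper-good {l} {r} (negative r≪l pos _) = subst (λ b → GoodJoin Above (leaves l) (leaves r) (upperJoin b)) (sym pos) (upper-skew r≪l)

module Lower = Enumeration below-kind lowerJoin lower-good
module Upper = Enumeration above-kind upperJoin upper-good

∸-+-interchange : ∀ {A B X Y} → X ≤ A → Y ≤ B → (A + B) ∸ (X + Y) ≡ (A ∸ X) + (B ∸ Y)
∸-+-interchange {A} {B} {X} {Y} X≤A Y≤B = begin
  (A + B) ∸ (X + Y)                           ≡⟨ cong₂ (λ u v → u + v ∸ (X + Y)) (sym (m+[n∸m]≡n X≤A)) (sym (m+[n∸m]≡n Y≤B)) ⟩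
  (X + (A ∸ X)) + (Y + (B ∸ Y)) ∸ (X + Y)     ≡⟨ cong (_∸ (X + Y)) (regroup X (A ∸ X) Y (B ∸ Y)) ⟩
  (X + Y) + ((A ∸ X) + (B ∸ Y)) ∸ (X + Y)     ≡⟨ m+n∸m≡n (X + Y) _ ⟩
  (A ∸ X) + (B ∸ Y)                           ∎
  where
  open ≡-Reasoning
  regroup : ∀ x a y b → x + a + (y + b) ≡ x + y + (a + b)
  regroup = solve-∀

module _ (q : ℕ) where

  shuffle-sum-inv : ∀ a b → b ≪ a → sumOver (λ s → q ^ inv s) (shuffles a b) ≡ q ^ inv a * q ^ inv b * gauss q (length a) (length b)
  shuffle-sum-inv a b b≪a = begin
    sumOver (λ s → q ^ inv s) (shuffles a b)
      ≡⟨ sumOver-cong (shuffles a b) (λ {s} s∈ → split {s} (interleaving-inv b≪a (∈-shuffles⁻ a b s∈))) ⟩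
    sumOver (λ s → q ^ (inv a + inv b) * shuffleWeight q a b s) (shuffles a b)
      ≡⟨ sumOver-*ˡ (q ^ (inv a + inv b)) (shuffleWeight q a b) (shuffles a b) ⟩
    q ^ (inv a + inv b) * sumOver (shuffleWeight q a b) (shuffles a b)
      ≡⟨ cong₂ _*_ (^-distribˡ-+-* q (inv a) (inv b)) (shuffle-sum q a b b≪a) ⟩
    q ^ inv a * q ^ inv b * gauss q (length a) (length b) ∎
    where
    open ≡-Reasoning
    split : ∀ {s} → inv a + inv b ≤ inv s → q ^ inv s ≡ q ^ (inv a + inv b) * shuffleWeight q a b s
    split {s} le = trans (cong (q ^_) (sym (m+[n∸m]≡n le))) (^-distribˡ-+-* q (inv a + inv b) (excess a b s))

  keep : Bool → ℕ → ℕ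
  keep b k = if b then k else 1

  nodeProduct : (Tree → Bool) → (Tree → Tree → ℕ) → Tree → ℕ
  nodeProduct σ B (leaf _)   = 1
  nodeProduct σ B (node l r) = nodeProduct σ B l * nodeProduct σ B r * keep (σ (node l r)) (B l r)

  lowerPoly upperPoly : Tree → ℕ
  lowerPoly = nodeProduct isNeg (λ l r → gauss q (N l) (N r))
  upperPoly = nodeProduct isPos (λ l r → gauss q (N r) (N l))

  lower-sum : ∀ T → IsSepTree T → sumOver (λ u → q ^ inv u) (enum lowerJoin T) ≡ lowerPoly T
  lower-sum (leaf a)   _ = refl
  lower-sum (node l r) (sl , sr , side) with orientation l r side
  ... | positive l≪r pos neg rewrite pos | neg =
    trans (sumOver-combine _ f f f 1 _ _ λ a∈ b∈ → concat-term (Lower.enum-member l sl a∈) (Lower.enum-member r sr b∈))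
          (cong₂ (λ A B → A * B * 1) (lower-sum l sl) (lower-sum r sr))
    where
    f = λ u → q ^ inv u
    concat-term : ∀ {a b} → a ≼ leaves l → b ≼ leaves r → q ^ inv (a ++ b) + 0 ≡ q ^ inv a * q ^ inv b * 1
    concat-term {a} {b} a≼ b≼ = begin
      q ^ inv (a ++ b) + 0          ≡⟨ +-identityʳ _ ⟩
      q ^ inv (a ++ b)              ≡⟨ cong (q ^_) (inv-++-≪ a b (≪-resp-↭ (≼-↭ a≼) (≼-↭ b≼) l≪r)) ⟩
      q ^ (inv a + inv b)           ≡⟨ ^-distribˡ-+-* q (inv a) (inv b) ⟩
      q ^ inv a * q ^ inv b         ≡⟨ sym (*-identityʳ _) ⟩
      q ^ inv a * q ^ inv b * 1     ∎
      where open ≡-Reasoning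
  ... | negative r≪l pos neg rewrite pos | neg =
    trans (sumOver-combine _ f f f (gauss q (N l) (N r)) _ _ λ a∈ b∈ → shuffle-term (Lower.enum-member l sl a∈) (Lower.enum-member r sr b∈))
          (cong₂ (λ A B → A * B * gauss q (N l) (N r)) (lower-sum l sl) (lower-sum r sr))
    where
    f = λ u → q ^ inv u
    shuffle-term : ∀ {a b} → a ≼ leaves l → b ≼ leaves r →
      sumOver f (shuffles a b) ≡ q ^ inv a * q ^ inv b * gauss q (N l) (N r)
    shuffle-term {a} {b} a≼ b≼ =
      trans (shuffle-sum-inv a b (≪-resp-↭ (≼-↭ b≼) (≼-↭ a≼) r≪l))
            (cong₂ (λ m k → q ^ inv a * q ^ inv b * gauss q m k) (≼-length a≼) (≼-length b≼))

  concat-excess : ∀ {x y a b} → y ≪ x → x ≼ a → y ≼ b → inv (a ++ b) ∸ inv (x ++ y) ≡ (inv a ∸ inv x) + (inv b ∸ inv y)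
  concat-excess {x} {y} {a} {b} y≪x x≼a y≼b = begin
    inv (a ++ b) ∸ inv (x ++ y)
      ≡⟨ cong₂ _∸_ (inv-++-≫ a b (≪-resp-↭ (↭-sym (≼-↭ y≼b)) (↭-sym (≼-↭ x≼a)) y≪x)) (inv-++-≫ x y y≪x) ⟩
    inv a + inv b + length a * length b ∸ (inv x + inv y + length x * length y)
      ≡⟨ cong₂ (λ m k → inv a + inv b + length a * length b ∸ (inv x + inv y + m * k)) (≼-length x≼a) (≼-length y≼b) ⟩
    inv a + inv b + length a * length b ∸ (inv x + inv y + length a * length b)
      ≡⟨ cong₂ _∸_ (+-comm (inv a + inv b) _) (+-comm (inv x + inv y) _) ⟩
    length a * length b + (inv a + inv b) ∸ (length a * length b + (inv x + inv y))
      ≡⟨ [m+n]∸[m+o]≡n∸o (length a * length b) _ _ ⟩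
    (inv a + inv b) ∸ (inv x + inv y)
      ≡⟨ ∸-+-interchange (≼-inv x≼a) (≼-inv y≼b) ⟩
    (inv a ∸ inv x) + (inv b ∸ inv y) ∎
    where open ≡-Reasoning

  shuffle-sum-excess : ∀ {x y a b} → x ≪ y → x ≼ a → y ≼ b →
    sumOver (λ s → q ^ (inv s ∸ inv (x ++ y))) (shuffles b a) ≡ q ^ (inv a ∸ inv x) * q ^ (inv b ∸ inv y) * gauss q (length b) (length a)
  shuffle-sum-excess {x} {y} {a} {b} x≪y x≼a y≼b = begin
    sumOver (λ s → q ^ (inv s ∸ inv (x ++ y))) (shuffles b a)
      ≡⟨ sumOver-cong (shuffles b a) (λ {s} s∈ → cong (q ^_) (split {s} (interleaving-inv a≪b (∈-shuffles⁻ b a s∈)))) ⟩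
    sumOver (λ s → q ^ (D + excess b a s)) (shuffles b a)
      ≡⟨ sumOver-cong (shuffles b a) (λ {s} _ → ^-distribˡ-+-* q D (excess b a s)) ⟩
    sumOver (λ s → q ^ D * shuffleWeight q b a s) (shuffles b a)
      ≡⟨ sumOver-*ˡ (q ^ D) (shuffleWeight q b a) (shuffles b a) ⟩
    q ^ D * sumOver (shuffleWeight q b a) (shuffles b a)
      ≡⟨ cong₂ _*_ (^-distribˡ-+-* q (inv a ∸ inv x) (inv b ∸ inv y)) (shuffle-sum q b a a≪b) ⟩
    q ^ (inv a ∸ inv x) * q ^ (inv b ∸ inv y) * gauss q (length b) (length a) ∎
    where
    open ≡-Reasoning
    D = (inv a ∸ inv x) + (inv b ∸ inv y)
    a≪b : a ≪ b
    a≪b = ≪-resp-↭ (↭-sym (≼-↭ x≼a)) (↭-sym (≼-↭ y≼b)) x≪y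
    split : ∀ {s} → inv b + inv a ≤ inv s → inv s ∸ inv (x ++ y) ≡ D + excess b a s
    split {s} le = begin
      inv s ∸ inv (x ++ y)                                ≡⟨ cong₂ _∸_ (sym (m+[n∸m]≡n le)) (inv-++-≪ x y x≪y) ⟩
      (inv b + inv a) + excess b a s ∸ (inv x + inv y)    ≡⟨ cong (λ m → m + excess b a s ∸ (inv x + inv y)) (+-comm (inv b) (inv a)) ⟩
      (inv a + inv b) + excess b a s ∸ (inv x + inv y)    ≡⟨ +-∸-comm (excess b a s) (+-mono-≤ (≼-inv x≼a) (≼-inv y≼b)) ⟩
      (inv a + inv b) ∸ (inv x + inv y) + excess b a s    ≡⟨ cong (_+ excess b a s) (∸-+-interchange (≼-inv x≼a) (≼-inv y≼b)) ⟩
      D + excess b a s                                    ∎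

  upper-sum : ∀ T → IsSepTree T → sumOver (λ v → q ^ (inv v ∸ inv (leaves T))) (enum upperJoin T) ≡ upperPoly T
  upper-sum (leaf a)   _ = refl
  upper-sum (node l r) (sl , sr , side) with orientation l r side
  ... | positive l≪r pos _ rewrite pos =
    trans (sumOver-combine _ (g (x ++ y)) (g x) (g y) (gauss q (N r) (N l)) _ _ λ a∈ b∈ →
             shuffle-term (Upper.enum-member l sl a∈) (Upper.enum-member r sr b∈))
          (cong₂ (λ A B → A * B * gauss q (N r) (N l)) (upper-sum l sl) (upper-sum r sr))
    where
    x = leaves l
    y = leaves r
    g = λ z v → q ^ (inv v ∸ inv z)
    shuffle-term : ∀ {a b} → x ≼ a → y ≼ b → sumOver (g (x ++ y)) (shuffles b a) ≡ g x a * g y b * gauss q (N r) (N l)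
    shuffle-term {a} {b} x≼a y≼b =
      trans (shuffle-sum-excess l≪r x≼a y≼b)
            (cong₂ (λ m k → g x a * g y b * gauss q m k) (sym (≼-length y≼b)) (sym (≼-length x≼a)))
  ... | negative r≪l pos _ rewrite pos =
    trans (sumOver-combine _ (g (x ++ y)) (g x) (g y) 1 _ _ λ a∈ b∈ →
             concat-term (Upper.enum-member l sl a∈) (Upper.enum-member r sr b∈))
          (cong₂ (λ A B → A * B * 1) (upper-sum l sl) (upper-sum r sr))
    where
    x = leaves l
    y = leaves r
    g = λ z v → q ^ (inv v ∸ inv z)
    concat-term : ∀ {a b} → x ≼ a → y ≼ b → g (x ++ y) (a ++ b) + 0 ≡ g x a * g y b * 1
    concat-term {a} {b} x≼a y≼b = begin
      g (x ++ y) (a ++ b) + 0                      ≡⟨ +-identityʳ _ ⟩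
      q ^ (inv (a ++ b) ∸ inv (x ++ y))            ≡⟨ cong (q ^_) (concat-excess r≪l x≼a y≼b) ⟩
      q ^ ((inv a ∸ inv x) + (inv b ∸ inv y))      ≡⟨ ^-distribˡ-+-* q (inv a ∸ inv x) (inv b ∸ inv y) ⟩
      g x a * g y b                                ≡⟨ sym (*-identityʳ _) ⟩
      g x a * g y b * 1                            ∎
      where open ≡-Reasoning

module _ (q : ℕ) where

  -- The children V, over all edges (P , V), with σ V but not σ P:
  -- freshNodes isNeg is S⁻ and freshNodes isPos is S⁺.
  freshNodes : (Tree → Bool) → Tree → List Tree
  freshNodes σ t = map proj₂ (filter (λ e → T? (σ (proj₂ e) ∧ not (σ (proj₁ e)))) (edges t))

  freshProduct : (Tree → Bool) → Tree → ℕ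
  freshProduct σ t = prodFact q (freshNodes σ t)

  signFactorial : (Tree → Bool) → Tree → ℕ
  signFactorial σ t = keep q (σ t) (qfact q (N t))

  private
    edgeFactor : (Tree × Tree → Bool) → Tree × Tree → ℕ
    edgeFactor g e = keep q (g e) (qfact q (N (proj₂ e)))

    edgeProduct : (Tree × Tree → Bool) → List (Tree × Tree) → ℕ
    edgeProduct g es = prodFact q (map proj₂ (filter (λ e → T? (g e)) es))

    edgeProduct-∷ : ∀ g e es → edgeProduct g (e ∷ es) ≡ edgeFactor g e * edgeProduct g es
    edgeProduct-∷ g e es with g e
    ... | true  = refl
    ... | false = sym (+-identityʳ _)

    edgeProduct-++ : ∀ g es fs → edgeProduct g (es ++ fs) ≡ edgeProduct g es * edgeProduct g fs
    edgeProduct-++ g es fs = begin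
      prodFact q (map proj₂ (filter G? (es ++ fs)))
        ≡⟨ cong (prodFact q ∘ map proj₂) (filter-++ G? es fs) ⟩
      prodFact q (map proj₂ (filter G? es ++ filter G? fs))
        ≡⟨ cong (prodFact q) (map-++ proj₂ (filter G? es) _) ⟩
      prodFact q (map proj₂ (filter G? es) ++ map proj₂ (filter G? fs))
        ≡⟨ cong product (map-++ (λ V → qfact q (N V)) (map proj₂ (filter G? es)) _) ⟩
      product (map (λ V → qfact q (N V)) (map proj₂ (filter G? es)) ++ map (λ V → qfact q (N V)) (map proj₂ (filter G? fs)))
        ≡⟨ product-++ (map (λ V → qfact q (N V)) (map proj₂ (filter G? es))) _ ⟩
      edgeProduct g es * edgeProduct g fs ∎
      where
      open ≡-Reasoning
      G? = λ e → T? (g e)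

  freshProduct-node : ∀ σ l r → let V = node l r in
    freshProduct σ V ≡ keep q (σ l ∧ not (σ V)) (qfact q (N l)) * (keep q (σ r ∧ not (σ V)) (qfact q (N r)) * (freshProduct σ l * freshProduct σ r))
  freshProduct-node σ l r =
    trans (edgeProduct-∷ g (V , l) _) (cong (edgeFactor g (V , l) *_)
      (trans (edgeProduct-∷ g (V , r) _) (cong (edgeFactor g (V , r) *_) (edgeProduct-++ g (edges l) (edges r)))))
    where
    V = node l r
    g = λ (e : Tree × Tree) → σ (proj₂ e) ∧ not (σ (proj₁ e))

  freshProduct-inside : ∀ σ l r → σ (node l r) ≡ true → freshProduct σ (node l r) ≡ freshProduct σ l * freshProduct σ r
  freshProduct-inside σ l r σV rewrite freshProduct-node σ l r | σV | ∧-zeroʳ (σ l) | ∧-zeroʳ (σ r) = trans (*-identityˡ _) (*-identityˡ _)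

  freshProduct-outside : ∀ σ l r → σ (node l r) ≡ false →
    freshProduct σ (node l r) ≡ signFactorial σ l * (signFactorial σ r * (freshProduct σ l * freshProduct σ r))
  freshProduct-outside σ l r σV rewrite freshProduct-node σ l r | σV | ∧-identityʳ (σ l) | ∧-identityʳ (σ r) = refl

  module Telescope (σ τ : Tree → Bool) (B : Tree → Tree → ℕ)
    (σ-leaf : ∀ a → σ (leaf a) ≡ false) (τ-leaf : ∀ a → τ (leaf a) ≡ false)
    (sign : ∀ {l r} → Orientation l r →
      (σ (node l r) ≡ true × τ (node l r) ≡ false) ⊎ (σ (node l r) ≡ false × τ (node l r) ≡ true))
    (B-qfact : ∀ l r → B l r * qfact q (N l) * qfact q (N r) ≡ qfact q (N (node l r))) where

    signFactorials : ∀ t → IsSepTree t → signFactorial σ t * signFactorial τ t ≡ qfact q (N t)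
    signFactorials (leaf a) _ rewrite σ-leaf a | τ-leaf a = refl
    signFactorials (node l r) (_ , _ , side) with sign (orientation l r side)
    ... | inj₁ (σV , τV) rewrite σV | τV = *-identityʳ _
    ... | inj₂ (σV , τV) rewrite σV | τV = *-identityˡ _

    telescope : ∀ T → IsSepTree T → nodeProduct q σ B T * freshProduct τ T ≡ freshProduct σ T * signFactorial σ T
    telescope (leaf a) _ rewrite σ-leaf a = refl
    telescope (node l r) (sl , sr , side) with sign (orientation l r side)
    ... | inj₁ (σV , τV) rewrite freshProduct-outside τ l r τV | freshProduct-inside σ l r σV | σV = begin
      Gl * Gr * B l r * (sτl * (sτr * (Fτl * Fτr)))        ≡⟨ regroup₁ Gl Gr (B l r) sτl sτr Fτl Fτr ⟩
      B l r * (Gl * Fτl) * (Gr * Fτr) * sτl * sτr          ≡⟨ cong₂ (λ u v → B l r * u * v * sτl * sτr) (telescope l sl) (telescope r sr) ⟩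
      B l r * (Fσl * sσl) * (Fσr * sσr) * sτl * sτr        ≡⟨ regroup₂ (B l r) Fσl sσl Fσr sσr sτl sτr ⟩
      Fσl * Fσr * (B l r * (sσl * sτl) * (sσr * sτr))      ≡⟨ cong₂ (λ u v → Fσl * Fσr * (B l r * u * v)) (signFactorials l sl) (signFactorials r sr) ⟩
      Fσl * Fσr * (B l r * qfact q (N l) * qfact q (N r))  ≡⟨ cong (Fσl * Fσr *_) (B-qfact l r) ⟩
      Fσl * Fσr * qfact q (N (node l r))                   ∎
      where
      open ≡-Reasoning
      Gl = nodeProduct q σ B l ; Gr = nodeProduct q σ B r
      Fσl = freshProduct σ l ; Fσr = freshProduct σ r ; Fτl = freshProduct τ l ; Fτr = freshProduct τ r
      sσl = signFactorial σ l ; sσr = signFactorial σ r ; sτl = signFactorial τ l ; sτr = signFactorial τ r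
      regroup₁ : ∀ g h b s t f k → g * h * b * (s * (t * (f * k))) ≡ b * (g * f) * (h * k) * s * t
      regroup₁ = solve-∀
      regroup₂ : ∀ b f s f′ s′ t t′ → b * (f * s) * (f′ * s′) * t * t′ ≡ f * f′ * (b * (s * t) * (s′ * t′))
      regroup₂ = solve-∀
    ... | inj₂ (σV , τV) rewrite freshProduct-inside τ l r τV | freshProduct-outside σ l r σV | σV = begin
      Gl * Gr * 1 * (Fτl * Fτr)                            ≡⟨ regroup₁ Gl Gr Fτl Fτr ⟩
      (Gl * Fτl) * (Gr * Fτr)                              ≡⟨ cong₂ _*_ (telescope l sl) (telescope r sr) ⟩
      (Fσl * sσl) * (Fσr * sσr)                            ≡⟨ regroup₂ Fσl sσl Fσr sσr ⟩
      sσl * (sσr * (Fσl * Fσr)) * 1                        ∎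
      where
      open ≡-Reasoning
      Gl = nodeProduct q σ B l ; Gr = nodeProduct q σ B r
      Fσl = freshProduct σ l ; Fσr = freshProduct σ r ; Fτl = freshProduct τ l ; Fτr = freshProduct τ r
      sσl = signFactorial σ l ; sσr = signFactorial σ r
      regroup₁ : ∀ g h f k → g * h * 1 * (f * k) ≡ (g * f) * (h * k)
      regroup₁ = solve-∀
      regroup₂ : ∀ f s f′ s′ → (f * s) * (f′ * s′) ≡ s * (s′ * (f * f′)) * 1
      regroup₂ = solve-∀

  lower-telescope : ∀ T → IsSepTree T → lowerPoly q T * freshProduct isPos T ≡ freshProduct isNeg T * signFactorial isNeg T
  lower-telescope = Telescope.telescope isNeg isPos (λ l r → gauss q (N l) (N r)) (λ _ → refl) (λ _ → refl) sign B-qfact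
    where
    sign : ∀ {l r} → Orientation l r → (isNeg (node l r) ≡ true × isPos (node l r) ≡ false) ⊎ (isNeg (node l r) ≡ false × isPos (node l r) ≡ true)
    sign (positive _ pos neg) = inj₂ (neg , pos)
    sign (negative _ pos neg) = inj₁ (neg , pos)
    B-qfact : ∀ l r → gauss q (N l) (N r) * qfact q (N l) * qfact q (N r) ≡ qfact q (N (node l r))
    B-qfact l r = trans (gauss-qfact q (N l) (N r)) (cong (qfact q) (sym (length-++ (leaves l))))

  upper-telescope : ∀ T → IsSepTree T → upperPoly q T * freshProduct isNeg T ≡ freshProduct isPos T * signFactorial isPos T
  upper-telescope = Telescope.telescope isPos isNeg (λ l r → gauss q (N r) (N l)) (λ _ → refl) (λ _ → refl) sign B-qfact
    where
    sign : ∀ {l r} → Orientation l r → (isPos (node l r) ≡ true × isNeg (node l r) ≡ false) ⊎ (isPos (node l r) ≡ false × isNeg (node l r) ≡ true)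
    sign (positive _ pos neg) = inj₁ (pos , neg)
    sign (negative _ pos neg) = inj₂ (pos , neg)
    B-qfact : ∀ l r → gauss q (N r) (N l) * qfact q (N l) * qfact q (N r) ≡ qfact q (N (node l r))
    B-qfact l r = begin
      gauss q (N r) (N l) * qfact q (N l) * qfact q (N r) ≡⟨ *-assoc (gauss q (N r) (N l)) (qfact q (N l)) _ ⟩
      gauss q (N r) (N l) * (qfact q (N l) * qfact q (N r)) ≡⟨ cong (gauss q (N r) (N l) *_) (*-comm (qfact q (N l)) _) ⟩
      gauss q (N r) (N l) * (qfact q (N r) * qfact q (N l)) ≡⟨ sym (*-assoc (gauss q (N r) (N l)) (qfact q (N r)) _) ⟩
      gauss q (N r) (N l) * qfact q (N r) * qfact q (N l) ≡⟨ gauss-qfact q (N r) (N l) ⟩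
      qfact q (N r + N l)                                 ≡⟨ cong (qfact q) (+-comm (N r) (N l)) ⟩
      qfact q (N l + N r)                                 ≡⟨ cong (qfact q) (sym (length-++ (leaves l))) ⟩
      qfact q (N (node l r))                              ∎
      where open ≡-Reasoning

sumOver-same-set : ∀ f {L E} → Unique L → Unique E → (∀ {u} → u ∈ L ⇔ u ∈ E) → sumOver f L ≡ sumOver f E
sumOver-same-set f uL uE L⇔E = sum-↭ (↭-map⁺ f (∼bag⇒↭ (unique∧set⇒bag uL uE L⇔E)))

lower-interval : ∀ {n π u} → π ↭ range n → (range n ≤w u × u ≤w π) ⇔ u ≼ π
lower-interval {n} π↭ = mk⇔ (λ (_ , u≤π) → ≤w⇒≼ u≤π)
  (λ u≼π → ≼⇒≤w (increasing-bottom (range-increasing n) (↭-trans (≼-↭ u≼π) π↭)) , ≼⇒≤w u≼π)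

upper-interval : ∀ {n π v} → π ↭ range n → (π ≤w v × v ≤w w₀ n) ⇔ π ≼ v
upper-interval {n} π↭ = mk⇔ (λ (π≤v , _) → ≤w⇒≼ π≤v)
  (λ π≼v → ≼⇒≤w π≼v ,
    ≼⇒≤w (decreasing-top (w₀-decreasing n) (↭-trans (↭-sym (≼-↭ π≼v)) (↭-trans π↭ (↭-sym (↭-reverse (range n)))))))

lower-formula : ∀ {n π T L} q → π ↭ range n → SeparatingTree T π → Unique L → (∀ u → u ∈ L ⇔ (range n ≤w u × u ≤w π)) →
  FΛ q L * prodFact q (Splus T) ≡ prodFact q (Sminus T) * signFactorial q isNeg T
lower-formula {T = T} {L} q π↭ (sepT , refl) uL L⇔ = begin
  FΛ q L * prodFact q (Splus T)                     ≡⟨ cong (_* prodFact q (Splus T)) (sumOver-same-set _ uL (Lower.enum-unique T sepT) L⇔enum) ⟩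
  sumOver (λ u → q ^ inv u) (enum lowerJoin T) * _  ≡⟨ cong (_* prodFact q (Splus T)) (lower-sum q T sepT) ⟩
  lowerPoly q T * prodFact q (Splus T)              ≡⟨ lower-telescope q T sepT ⟩
  prodFact q (Sminus T) * signFactorial q isNeg T   ∎
  where
  open ≡-Reasoning
  L⇔enum : ∀ {u} → u ∈ L ⇔ u ∈ enum lowerJoin T
  L⇔enum = ⇔.trans (L⇔ _) (⇔.trans (lower-interval π↭) (⇔.sym (Lower.∈-enum T sepT)))

upper-formula : ∀ {n π T M} q → π ↭ range n → SeparatingTree T π → Unique M → (∀ v → v ∈ M ⇔ (π ≤w v × v ≤w w₀ n)) →
  FV q π M * prodFact q (Sminus T) ≡ prodFact q (Splus T) * signFactorial q isPos T
upper-formula {π = π} {T} {M} q π↭ (sepT , refl) uM M⇔ = begin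
  FV q π M * prodFact q (Sminus T)                                       ≡⟨ cong (_* prodFact q (Sminus T)) (sumOver-same-set _ uM (Upper.enum-unique T sepT) M⇔enum) ⟩
  sumOver (λ v → q ^ (inv v ∸ inv π)) (enum upperJoin T) * _             ≡⟨ cong (_* prodFact q (Sminus T)) (upper-sum q T sepT) ⟩
  upperPoly q T * prodFact q (Sminus T)                                  ≡⟨ upper-telescope q T sepT ⟩
  prodFact q (Splus T) * signFactorial q isPos T                         ∎
  where
  open ≡-Reasoning
  M⇔enum : ∀ {v} → v ∈ M ⇔ v ∈ enum upperJoin T
  M⇔enum = ⇔.trans (M⇔ _) (⇔.trans (upper-interval π↭) (⇔.sym (Upper.∈-enum T sepT)))

pos⇒¬neg : ∀ t → isPos t ≡ true → isNeg t ≡ false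
pos⇒¬neg (node l r) pos = <ᵇ-false (<⇒≯ (<ᵇ⇒< (firstLeaf l) (firstLeaf r) (subst T (sym pos) tt)))

neg⇒¬pos : ∀ t → isNeg t ≡ true → isPos t ≡ false
neg⇒¬pos (node l r) neg = <ᵇ-false (<⇒≯ (<ᵇ⇒< (firstLeaf r) (firstLeaf l) (subst T (sym neg) tt)))

-- Theorem 3.5, with the quotients of the statement cleared of denominators.
theorem3p5 : (n : ℕ) → 2 ≤ n → (π : List ℕ) → π ↭ range n → Separable π →
    (T : Tree) → SeparatingTree T π →
    (L : List (List ℕ)) → Unique L → (∀ u → u ∈ L ⇔ (range n ≤w u × u ≤w π)) →
    (M : List (List ℕ)) → Unique M → (∀ v → v ∈ M ⇔ (π ≤w v × v ≤w w₀ n)) →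
    (q : ℕ) →
    ((isPos T ≡ true →
        (FΛ q L * prodFact q (Splus T) ≡ prodFact q (Sminus T))
      × (FV q π M * prodFact q (Sminus T) ≡ prodFact q (Splus T) * qfact q (N T)))
    × (isNeg T ≡ true →
        (FΛ q L * prodFact q (Splus T) ≡ prodFact q (Sminus T) * qfact q (N T))
      × (FV q π M * prodFact q (Sminus T) ≡ prodFact q (Splus T))))
theorem3p5 n _ π π↭ _ T sepT L uL L⇔ M uM M⇔ q =
  (λ pos → trans lower (trans (cong (Mt *_) (root isNeg (pos⇒¬neg T pos))) (*-identityʳ Mt)) ,
           trans upper (cong (Pt *_) (root isPos pos))) ,
  (λ neg → trans lower (cong (Mt *_) (root isNeg neg)) ,
           trans upper (trans (cong (Pt *_) (root isPos (neg⇒¬pos T neg))) (*-identityʳ Pt)))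
  where
  Mt = prodFact q (Sminus T)
  Pt = prodFact q (Splus T)
  lower = lower-formula q π↭ sepT uL L⇔
  upper = upper-formula q π↭ sepT uM M⇔
  root : ∀ σ {b} → σ T ≡ b → signFactorial q σ T ≡ keep q b (qfact q (N T))
  root σ σT = cong (λ b → keep q b (qfact q (N T))) σT
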